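{- Let $n \equiv 3 \pmod 4$ be a prime. Suppose there exist circulant $\pm1$ matrices $X, Y$ of order $n$, with $X$ symmetric, such that $XX^\top + YY^\top = (2n-2)I_n + 2J_n$ (i.e. a $D$-optimal design of order $2n$ constructed from two circulant matrices, one of which is symmetric). Then there exists a propus-Hadamard matrix of order $4n$.
   Context: $I_n$ is the identity and $J_n$ the all-ones matrix of order $n$; $R$ denotes the back-diagonal identity matrix of order $n$. A Hadamard matrix of order $m$ is an $m\times m$ $\pm1$ matrix $H$ with $HH^\top = mI_m$. A propus-Hadamard matrix of order $4n$ is a Hadamard matrix obtained by substituting $\pm1$ matrices $A, B, D$ of order $n$ satisfying $AA^\top + 2BB^\top + DD^\top = 4nI_n$ into either the propus array \[ P = \begin{bmatrix} A & B & B & D \\ B & D & -A & -B \\ B & -A & -D & B \\ D & -B & B & -A \end{bmatrix} \] or the generalized propus array \[ GP = \begin{bmatrix} A & BR & BR & DR \\ BR & D^\top R & -A & -B^\top R \\ BR & -A & -D^\top R & B^\top R \\ DR & -B^\top R & B^\top R & -A \end{bmatrix}. \] -}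

module Defs where

open import Data.Nat as ℕ using (ℕ; zero; suc)
open import Data.Fin as Fin using (Fin; toℕ; remQuot; opposite)
open import Data.Fin.Properties using () renaming (_≟_ to _≟ᶠ_)
open import Data.Integer as ℤ using (ℤ; +_; _+_; _*_; -_; _-_)
open import Data.Integer.Divisibility using (_∣_)
open import Data.Product using (Σ; _×_; _,_; ∃-syntax)
open import Data.Sum using (_⊎_)
open import Relation.Binary.PropositionalEquality using (_≡_)
open import Relation.Nullary using (yes; no)

Mat : ℕ → Set
Mat n = Fin n → Fin n → ℤ

Σᶠ : ∀ {n} → (Fin n → ℤ) → ℤ
Σᶠ {zero}  f = + 0
Σᶠ {suc n} f = f Fin.zero + Σᶠ (λ i → f (Fin.suc i))

_≐_ : ∀ {n} → Mat n → Mat n → Set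
A ≐ B = ∀ i j → A i j ≡ B i j

_⊕_ : ∀ {n} → Mat n → Mat n → Mat n
(A ⊕ B) i j = A i j + B i j

_⊗_ : ∀ {n} → Mat n → Mat n → Mat n
(A ⊗ B) i j = Σᶠ (λ k → A i k * B k j)

_·_ : ∀ {n} → ℤ → Mat n → Mat n
(c · A) i j = c * A i j

neg : ∀ {n} → Mat n → Mat n
neg A i j = - A i j

_ᵀ : ∀ {n} → Mat n → Mat n
(A ᵀ) i j = A j i

I : ∀ {n} → Mat n
I i j with i ≟ᶠ j
... | yes _ = + 1
... | no  _ = + 0

J : ∀ {n} → Mat n
J i j = + 1

R : ∀ {n} → Mat n
R i j with opposite i ≟ᶠ j
... | yes _ = + 1
... | no  _ = + 0

IsPM1 : ∀ {n} → Mat n → Set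
IsPM1 A = ∀ i j → (A i j ≡ + 1) ⊎ (A i j ≡ - (+ 1))

Symmetric : ∀ {n} → Mat n → Set
Symmetric A = A ≐ (A ᵀ)

Circulant : ∀ {n} → Mat n → Set
Circulant {n} A = ∀ i j i' j' →
  (+ n) ∣ ((+ toℕ j - + toℕ i) - (+ toℕ j' - + toℕ i')) → A i j ≡ A i' j'

IsHadamard : ∀ {m} → Mat m → Set
IsHadamard {m} H = IsPM1 H × ((H ⊗ (H ᵀ)) ≐ ((+ m) · I))

-- 4×4 block matrix of order 4n (row-major blocks, via Fin.remQuot)
block4 : ∀ {n} → (Fin 4 → Fin 4 → Mat n) → Mat (4 ℕ.* n)
block4 {n} M r c with remQuot {4} n r | remQuot {4} n c
... | (br , ir) | (bc , ic) = M br bc ir ic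

arr : ∀ {n} → Mat n → Mat n → Mat n → Mat n →
               Mat n → Mat n → Mat n → Mat n →
               Mat n → Mat n → Mat n → Mat n →
               Mat n → Mat n → Mat n → Mat n → Fin 4 → Fin 4 → Mat n
arr a b c d e f g h i j k l m n' o p r s = go r s
  where
  row : Mat _ → Mat _ → Mat _ → Mat _ → Fin 4 → _
  row x₀ x₁ x₂ x₃ Fin.zero = x₀
  row x₀ x₁ x₂ x₃ (Fin.suc Fin.zero) = x₁
  row x₀ x₁ x₂ x₃ (Fin.suc (Fin.suc Fin.zero)) = x₂
  row x₀ x₁ x₂ x₃ (Fin.suc (Fin.suc (Fin.suc Fin.zero))) = x₃
  go : Fin 4 → Fin 4 → Mat _
  go Fin.zero = row a b c d
  go (Fin.suc Fin.zero) = row e f g h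
  go (Fin.suc (Fin.suc Fin.zero)) = row i j k l
  go (Fin.suc (Fin.suc (Fin.suc Fin.zero))) = row m n' o p

propus : ∀ {n} → Mat n → Mat n → Mat n → Mat (4 ℕ.* n)
propus A B D = block4 (arr
  A      B      B      D
  B      D      (neg A) (neg B)
  B      (neg A) (neg D) B
  D      (neg B) B      (neg A))

genPropus : ∀ {n} → Mat n → Mat n → Mat n → Mat (4 ℕ.* n)
genPropus A B D = block4 (arr
  A          (B ⊗ R)          (B ⊗ R)          (D ⊗ R)
  (B ⊗ R)    ((D ᵀ) ⊗ R)      (neg A)          (neg ((B ᵀ) ⊗ R))
  (B ⊗ R)    (neg A)          (neg ((D ᵀ) ⊗ R)) ((B ᵀ) ⊗ R)
  (D ⊗ R)    (neg ((B ᵀ) ⊗ R)) ((B ᵀ) ⊗ R)     (neg A))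

IsPropusHadamard : ∀ n → Mat (4 ℕ.* n) → Set
IsPropusHadamard n H = IsHadamard H × ∃[ A ] ∃[ B ] ∃[ D ]
  ( IsPM1 {n} A × IsPM1 B × IsPM1 D
  × (((A ⊗ (A ᵀ)) ⊕ ((+ 2) · (B ⊗ (B ᵀ)))) ⊕ (D ⊗ (D ᵀ))) ≐ ((+ (4 ℕ.* n)) · I)
  × (H ≐ propus A B D ⊎ H ≐ genPropus A B D))

-- Take the generalised propus array GP(X, B, Y), where B is the circulant matrix of the
-- Legendre sequence χ modulo n (with χ 0 = 1). For n ≡ 3 (mod 4) the periodic autocorrelation of χ is
-- -1 off zero, i.e. BBᵀ = (n + 1)I - J, so XXᵀ + 2BBᵀ + YYᵀ = (2n - 2)I + 2J + 2(n + 1)I - 2J = 4nI.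
-- Every block of GP is a circulant C or a back-circulant C ⊗ R, Cᵀ ⊗ R; a circulant and a back-circulant
-- are amicable, and C ⊗ R, Cᵀ ⊗ R have the Gram matrix of C, so in GP·GPᵀ the off-diagonal blocks cancel
-- and every diagonal block is XXᵀ + 2BBᵀ + YYᵀ.
-- The autocorrelation of χ comes from counting square roots: if r(k) = #{y : y² ≡ k}, then for d ≢ 0
-- ∑ₖ r(k) r(k + d) = n - 1, and reducing this identity mod 4 shows r(d) + r(-d) = 2.

module Submission where

open import Defs
open import Data.Nat as ℕ using (ℕ; zero; suc; NonZero; _<_; z<s; s<s; z≤n; s≤s; _%_)
import Data.Nat.Properties as ℕP
import Data.Nat.Divisibility as ℕD
open import Data.Nat.DivMod using (m≡m%n+[m/n]*n)
open import Data.Nat.Primality using (Prime; euclidsLemma; prime⇒irreducible)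
import Data.Nat.Coprimality as Coprimality
open import Data.Nat.GCD using (module Bézout)
open import Data.Integer as ℤ using (ℤ; +_; -[1+_]; _+_; _*_; -_; _-_; ∣_∣)
import Data.Integer.Properties as ℤP
import Data.Integer.DivMod as ℤDM
open import Data.Integer.Divisibility using (_∣_)
import Data.Integer.Divisibility.Signed as Signed
open import Data.Integer.Tactic.RingSolver using (solve-∀)
open import Data.Fin as Fin using (Fin; toℕ; opposite; combine; remQuot; _↑ˡ_; _↑ʳ_)
import Data.Fin.Properties as FinP
open import Data.Fin.Properties using () renaming (_≟_ to _≟ᶠ_)
open import Data.Fin.Patterns using (0F; 1F; 2F; 3F)
open import Data.Product using (Σ; _×_; _,_; proj₁; proj₂; ∃-syntax)
open import Data.Sum using (_⊎_; inj₁; inj₂; [_,_])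
open import Data.Empty using (⊥-elim)
open import Relation.Nullary using (Dec; yes; no; ¬_)
open import Relation.Binary.Definitions using (tri<; tri≈; tri>)
open import Relation.Binary.PropositionalEquality hiding (J; [_])
open import Function using (_∘_)
open import Algebra.Properties.AbelianGroup ℤP.+-0-abelianGroup using () renaming (∙-cancelˡ to +-cancelˡ)

∑ : ℕ → (ℕ → ℤ) → ℤ
∑ zero    f = + 0
∑ (suc n) f = f 0 + ∑ n (λ k → f (suc k))

Σᶠ≡∑ : ∀ n (f : ℕ → ℤ) → Σᶠ {n} (λ k → f (toℕ k)) ≡ ∑ n f
Σᶠ≡∑ zero    f = refl
Σᶠ≡∑ (suc n) f = cong (_+_ (f 0)) (Σᶠ≡∑ n (λ k → f (suc k)))

Σᶠ-cong : ∀ {n} {f g : Fin n → ℤ} → (∀ i → f i ≡ g i) → Σᶠ f ≡ Σᶠ g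
Σᶠ-cong {zero}  e = refl
Σᶠ-cong {suc n} e = cong₂ _+_ (e Fin.zero) (Σᶠ-cong (λ i → e (Fin.suc i)))

∑-cong< : ∀ n {f g : ℕ → ℤ} → (∀ k → k < n → f k ≡ g k) → ∑ n f ≡ ∑ n g
∑-cong< zero    e = refl
∑-cong< (suc n) e = cong₂ _+_ (e 0 z<s) (∑-cong< n (λ k k<n → e (suc k) (s<s k<n)))

∑-cong : ∀ n {f g : ℕ → ℤ} → (∀ k → f k ≡ g k) → ∑ n f ≡ ∑ n g
∑-cong n e = ∑-cong< n (λ k _ → e k)

∑-+ : ∀ n (f g : ℕ → ℤ) → ∑ n (λ k → f k + g k) ≡ ∑ n f + ∑ n g
∑-+ zero    f g = refl
∑-+ (suc n) f g = trans (cong (_+_ (f 0 + g 0)) (∑-+ n (λ k → f (suc k)) (λ k → g (suc k))))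
                        (interchange (f 0) (g 0) _ _)
  where
  interchange : ∀ a b c d → (a + b) + (c + d) ≡ (a + c) + (b + d)
  interchange = solve-∀

∑-neg : ∀ n (f : ℕ → ℤ) → ∑ n (λ k → - f k) ≡ - ∑ n f
∑-neg zero    f = refl
∑-neg (suc n) f = trans (cong (_+_ (- f 0)) (∑-neg n _)) (sym (ℤP.neg-distrib-+ (f 0) _))

∑-*ˡ : ∀ n c (f : ℕ → ℤ) → ∑ n (λ k → c * f k) ≡ c * ∑ n f
∑-*ˡ zero    c f = sym (ℤP.*-zeroʳ c)
∑-*ˡ (suc n) c f = trans (cong (_+_ (c * f 0)) (∑-*ˡ n c _)) (sym (ℤP.*-distribˡ-+ c (f 0) _))

∑-*ʳ : ∀ n c (f : ℕ → ℤ) → ∑ n (λ k → f k * c) ≡ ∑ n f * c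
∑-*ʳ n c f = trans (∑-cong n (λ k → ℤP.*-comm (f k) c)) (trans (∑-*ˡ n c f) (ℤP.*-comm c _))

∑-const : ∀ n c → ∑ n (λ _ → c) ≡ + n * c
∑-const zero    c = sym (ℤP.*-zeroˡ c)
∑-const (suc n) c = begin
  c + ∑ n (λ _ → c)   ≡⟨ cong (_+_ c) (∑-const n c) ⟩
  c + + n * c         ≡⟨ cong (_+ + n * c) (ℤP.*-identityˡ c) ⟨
  + 1 * c + + n * c   ≡⟨ ℤP.*-distribʳ-+ c (+ 1) (+ n) ⟨
  + suc n * c         ∎
  where open ≡-Reasoning

∑-zero : ∀ n (f : ℕ → ℤ) → (∀ k → k < n → f k ≡ + 0) → ∑ n f ≡ + 0
∑-zero n f e = trans (∑-cong< n e) (trans (∑-const n (+ 0)) (ℤP.*-zeroʳ (+ n)))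

∑-single : ∀ n (f : ℕ → ℤ) a → a < n → (∀ k → k < n → k ≢ a → f k ≡ + 0) → ∑ n f ≡ f a
∑-single (suc n) f zero    _         e =
  trans (cong (_+_ (f 0)) (∑-zero n _ (λ k k<n → e (suc k) (s<s k<n) (λ ())))) (ℤP.+-identityʳ (f 0))
∑-single (suc n) f (suc a) (s<s a<n) e =
  trans (cong (_+ ∑ n (λ k → f (suc k))) (e 0 z<s (λ ())))
        (trans (ℤP.+-identityˡ _)
               (∑-single n (λ k → f (suc k)) a a<n (λ k k<n k≢a → e (suc k) (s<s k<n) (k≢a ∘ ℕP.suc-injective))))

∑-snoc : ∀ n (f : ℕ → ℤ) → ∑ (suc n) f ≡ ∑ n f + f n
∑-snoc zero    f = trans (ℤP.+-identityʳ (f 0)) (sym (ℤP.+-identityˡ (f 0)))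
∑-snoc (suc n) f = trans (cong (_+_ (f 0)) (∑-snoc n (λ k → f (suc k)))) (sym (ℤP.+-assoc (f 0) _ _))

∑-reverse : ∀ n (f : ℕ → ℤ) → ∑ n f ≡ ∑ n (λ k → f (n ℕ.∸ suc k))
∑-reverse zero    f = refl
∑-reverse (suc n) f = begin
  f 0 + ∑ n (λ k → f (suc k))
    ≡⟨ cong (_+_ (f 0)) (∑-reverse n (λ k → f (suc k))) ⟩
  f 0 + ∑ n (λ k → f (suc (n ℕ.∸ suc k)))
    ≡⟨ cong (_+_ (f 0)) (∑-cong< n (λ k k<n → cong f (sym (ℕP.+-∸-assoc 1 k<n)))) ⟩
  f 0 + ∑ n (λ k → f (suc n ℕ.∸ suc k))
    ≡⟨ ℤP.+-comm (f 0) _ ⟩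
  ∑ n (λ k → f (suc n ℕ.∸ suc k)) + f 0
    ≡⟨ cong (λ m → ∑ n (λ k → f (suc n ℕ.∸ suc k)) + f m) (ℕP.n∸n≡0 n) ⟨
  ∑ n (λ k → f (suc n ℕ.∸ suc k)) + f (suc n ℕ.∸ suc n)
    ≡⟨ ∑-snoc n (λ k → f (suc n ℕ.∸ suc k)) ⟨
  ∑ (suc n) (λ k → f (suc n ℕ.∸ suc k))
    ∎
  where open ≡-Reasoning

∑-swap : ∀ m n (f : ℕ → ℕ → ℤ) → ∑ m (λ i → ∑ n (f i)) ≡ ∑ n (λ j → ∑ m (λ i → f i j))
∑-swap zero    n f = sym (∑-zero n _ (λ _ _ → refl))
∑-swap (suc m) n f = trans (cong (_+_ (∑ n (f 0))) (∑-swap m n (λ i → f (suc i))))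
                           (sym (∑-+ n (f 0) (λ j → ∑ m (λ i → f (suc i) j))))

⟪_,_⟫ : ∀ {n} → Mat n → Mat n → Mat n
⟪ M , M′ ⟫ = M ⊗ (M′ ᵀ)

Σᶠ-neg : ∀ {n} (f : Fin n → ℤ) → Σᶠ (λ k → - f k) ≡ - Σᶠ f
Σᶠ-neg {zero}  f = refl
Σᶠ-neg {suc n} f = trans (cong (_+_ (- f Fin.zero)) (Σᶠ-neg (f ∘ Fin.suc))) (sym (ℤP.neg-distrib-+ (f Fin.zero) _))

Σᶠ-zero : ∀ n → Σᶠ {n} (λ _ → + 0) ≡ + 0
Σᶠ-zero zero    = refl
Σᶠ-zero (suc n) = trans (ℤP.+-identityˡ _) (Σᶠ-zero n)

Σᶠ-single : ∀ {n} (f : Fin n → ℤ) a → (∀ k → k ≢ a → f k ≡ + 0) → Σᶠ f ≡ f a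
Σᶠ-single {suc n} f Fin.zero    e =
  trans (cong (_+_ (f Fin.zero)) (trans (Σᶠ-cong (λ k → e (Fin.suc k) (λ ()))) (Σᶠ-zero n))) (ℤP.+-identityʳ _)
Σᶠ-single {suc n} f (Fin.suc a) e =
  trans (cong (_+ Σᶠ (f ∘ Fin.suc)) (e Fin.zero (λ ())))
        (trans (ℤP.+-identityˡ _) (Σᶠ-single (f ∘ Fin.suc) a (λ k k≢a → e (Fin.suc k) (k≢a ∘ FinP.suc-injective))))

Σᶠ-++ : ∀ a {b} (f : Fin (a ℕ.+ b) → ℤ) → Σᶠ f ≡ Σᶠ (λ i → f (i ↑ˡ b)) + Σᶠ (λ j → f (a ↑ʳ j))
Σᶠ-++ zero    f = sym (ℤP.+-identityˡ _)
Σᶠ-++ (suc a) f = trans (cong (_+_ (f Fin.zero)) (Σᶠ-++ a (f ∘ Fin.suc))) (sym (ℤP.+-assoc (f Fin.zero) _ _))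

Σᶠ-combine : ∀ m n (f : Fin (m ℕ.* n) → ℤ) → Σᶠ f ≡ Σᶠ {m} (λ b → Σᶠ {n} (λ k → f (combine b k)))
Σᶠ-combine zero    n f = refl
Σᶠ-combine (suc m) n f = trans (Σᶠ-++ n f) (cong (_+_ (Σᶠ (λ i → f (i ↑ˡ (m ℕ.* n))))) (Σᶠ-combine m n (λ j → f (n ↑ʳ j))))

⟪neg,⟫ : ∀ {n} (M M′ : Mat n) i j → ⟪ neg M , M′ ⟫ i j ≡ - ⟪ M , M′ ⟫ i j
⟪neg,⟫ M M′ i j = trans (Σᶠ-cong (λ k → sym (ℤP.neg-distribˡ-* (M i k) (M′ j k)))) (Σᶠ-neg (λ k → M i k * M′ j k))

⟪,neg⟫ : ∀ {n} (M M′ : Mat n) i j → ⟪ M , neg M′ ⟫ i j ≡ - ⟪ M , M′ ⟫ i j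
⟪,neg⟫ M M′ i j = trans (Σᶠ-cong (λ k → sym (ℤP.neg-distribʳ-* (M i k) (M′ j k)))) (Σᶠ-neg (λ k → M i k * M′ j k))

⟪neg,neg⟫ : ∀ {n} (M M′ : Mat n) i j → ⟪ neg M , neg M′ ⟫ i j ≡ ⟪ M , M′ ⟫ i j
⟪neg,neg⟫ M M′ i j = trans (⟪neg,⟫ M (neg M′) i j) (trans (cong -_ (⟪,neg⟫ M M′ i j)) (ℤP.neg-involutive _))

⟪⟫-comm : ∀ {n} (M M′ : Mat n) i j → ⟪ M , M′ ⟫ i j ≡ ⟪ M′ , M ⟫ j i
⟪⟫-comm M M′ i j = Σᶠ-cong (λ k → ℤP.*-comm (M i k) (M′ j k))

⊗R-entry : ∀ {n} (M : Mat n) i j → (M ⊗ R) i j ≡ M i (opposite j)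
⊗R-entry M i j = trans (Σᶠ-single (λ k → M i k * R k j) (opposite j) off) (on j)
  where
  off : ∀ k → k ≢ opposite j → M i k * R k j ≡ + 0
  off k k≢ with opposite k ≟ᶠ j
  ... | yes refl = ⊥-elim (k≢ (sym (FinP.opposite-involutive k)))
  ... | no _     = ℤP.*-zeroʳ (M i k)
  on : ∀ j → M i (opposite j) * R (opposite j) j ≡ M i (opposite j)
  on j with opposite (opposite j) ≟ᶠ j
  ... | yes _ = ℤP.*-identityʳ _
  ... | no ≢j = ⊥-elim (≢j (FinP.opposite-involutive j))

I-diagonal : ∀ {n} (i : Fin n) → I i i ≡ + 1
I-diagonal i with i ≟ᶠ i
... | yes _   = refl
... | no i≢i = ⊥-elim (i≢i refl)

I-off-diagonal : ∀ {n} {i j : Fin n} → i ≢ j → I i j ≡ + 0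
I-off-diagonal {i = i} {j} i≢j with i ≟ᶠ j
... | yes i≡j = ⊥-elim (i≢j i≡j)
... | no _    = refl

±1 : ℤ → Set
±1 v = (v ≡ + 1) ⊎ (v ≡ - + 1)

±1-neg : ∀ {v} → ±1 v → ±1 (- v)
±1-neg (inj₁ refl) = inj₂ refl
±1-neg (inj₂ refl) = inj₁ refl

IsPM1-neg : ∀ {n} {M : Mat n} → IsPM1 M → IsPM1 (neg M)
IsPM1-neg pm i j = ±1-neg (pm i j)

IsPM1-ᵀ : ∀ {n} {M : Mat n} → IsPM1 M → IsPM1 (M ᵀ)
IsPM1-ᵀ pm i j = pm j i

IsPM1-⊗R : ∀ {n} {M : Mat n} → IsPM1 M → IsPM1 (M ⊗ R)
IsPM1-⊗R {M = M} pm i j = subst ±1 (sym (⊗R-entry M i j)) (pm i (opposite j))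

block4-combine : ∀ {n} (F : Fin 4 → Fin 4 → Mat n) b i b′ j → block4 F (combine b i) (combine b′ j) ≡ F b b′ i j
block4-combine F b i b′ j =
  cong₂ (λ u v → F (proj₁ u) (proj₁ v) (proj₂ u) (proj₂ v)) (FinP.remQuot-combine b i) (FinP.remQuot-combine b′ j)

∀-combine : ∀ {n} (P : Fin (4 ℕ.* n) → Fin (4 ℕ.* n) → Set) → (∀ b i b′ j → P (combine b i) (combine b′ j)) → ∀ r c → P r c
∀-combine {n} P h r c = subst₂ P (FinP.combine-remQuot {4} n r) (FinP.combine-remQuot {4} n c)
  (h (proj₁ (remQuot {4} n r)) (proj₂ (remQuot {4} n r)) (proj₁ (remQuot {4} n c)) (proj₂ (remQuot {4} n c)))

block4-IsPM1 : ∀ {n} (F : Fin 4 → Fin 4 → Mat n) → (∀ b b′ → IsPM1 (F b b′)) → IsPM1 (block4 F)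
block4-IsPM1 F pm = ∀-combine (λ r c → ±1 (block4 F r c))
  (λ b i b′ j → subst ±1 (sym (block4-combine F b i b′ j)) (pm b b′ i j))

block4-gram : ∀ {n} (F : Fin 4 → Fin 4 → Mat n) b i b′ j →
  ⟪ block4 F , block4 F ⟫ (combine b i) (combine b′ j) ≡ Σᶠ (λ c → ⟪ F b c , F b′ c ⟫ i j)
block4-gram {n} F b i b′ j =
  trans (Σᶠ-combine 4 n (λ k → block4 F (combine b i) k * block4 F (combine b′ j) k))
        (Σᶠ-cong (λ c → Σᶠ-cong (λ k → cong₂ _*_ (block4-combine F b i c k) (block4-combine F b′ j c k))))

I-combine-≡ : ∀ {m n} (b : Fin m) (i j : Fin n) → I (combine b i) (combine b j) ≡ I i j
I-combine-≡ b i j with i ≟ᶠ j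
... | yes refl = I-diagonal (combine b i)
... | no i≢j   = I-off-diagonal (i≢j ∘ FinP.combine-injectiveʳ b i b j)

I-combine-≢ : ∀ {m n} {b b′ : Fin m} (i j : Fin n) → b ≢ b′ → I (combine b i) (combine b′ j) ≡ + 0
I-combine-≢ {b = b} {b′} i j b≢b′ = I-off-diagonal (b≢b′ ∘ FinP.combine-injectiveˡ b i b′ j)

-- Unsigned divisibility on ℤ, transported from the signed lemmas

∣m∣n⇒∣m+n : ∀ {k a b} → k ∣ a → k ∣ b → k ∣ a + b
∣m∣n⇒∣m+n {k} {a} {b} p q =
  Signed.∣⇒∣ᵤ {k} {a + b} (Signed.∣m∣n⇒∣m+n {k} {a} {b} (Signed.∣ᵤ⇒∣ {k} {a} p) (Signed.∣ᵤ⇒∣ {k} {b} q))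

∣m⇒∣-m : ∀ {k a} → k ∣ a → k ∣ - a
∣m⇒∣-m {k} {a} = subst (∣ k ∣ ℕD.∣_) (sym (ℤP.∣-i∣≡∣i∣ a))

∣-m⇒∣m : ∀ {k a} → k ∣ - a → k ∣ a
∣-m⇒∣m {k} {a} = subst (∣ k ∣ ℕD.∣_) (ℤP.∣-i∣≡∣i∣ a)

∣m∣n⇒∣m-n : ∀ {k a b} → k ∣ a → k ∣ b → k ∣ a - b
∣m∣n⇒∣m-n {k} {a} {b} p q = ∣m∣n⇒∣m+n {k} {a} { - b} p (∣m⇒∣-m {k} {b} q)

∣n⇒∣m*n : ∀ {k} m {a} → k ∣ a → k ∣ m * a
∣n⇒∣m*n {k} m {a} p = Signed.∣⇒∣ᵤ {k} {m * a} (Signed.∣n⇒∣m*n {k} m {a} (Signed.∣ᵤ⇒∣ {k} {a} p))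

∣m⇒∣m*n : ∀ {k} m {a} → k ∣ a → k ∣ a * m
∣m⇒∣m*n {k} m {a} p = Signed.∣⇒∣ᵤ {k} {a * m} (Signed.∣m⇒∣m*n {k} {a} m (Signed.∣ᵤ⇒∣ {k} {a} p))

n∣m*n : ∀ k m → k ∣ m * k
n∣m*n k m = ∣n⇒∣m*n {k} m {k} ℕD.∣-refl

∣-∑ : ∀ {c} n (f : ℕ → ℤ) → (∀ k → c ∣ f k) → c ∣ ∑ n f
∣-∑ zero    f c∣f = ℕD._∣0 _
∣-∑ {c} (suc n) f c∣f = ∣m∣n⇒∣m+n {c} {f 0} {∑ n (f ∘ suc)} (c∣f 0) (∣-∑ {c} n (f ∘ suc) (c∣f ∘ suc))

_∣?_ : ∀ k a → Dec (k ∣ a)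
k ∣? a = ∣ k ∣ ℕD.∣? ∣ a ∣

m+n-n≡m : ∀ m n → (m + n) - n ≡ m
m+n-n≡m = solve-∀

m+n-m≡n : ∀ m n → (m + n) - m ≡ n
m+n-m≡n = solve-∀

n∣t-t%n : ∀ t n .{{_ : NonZero n}} → + n ∣ t - + (t ℤ.%ℕ n)
n∣t-t%n t n = subst (+ n ∣_) (sym quotient) (n∣m*n (+ n) (t ℤ./ℕ n))
  where
  quotient : t - + (t ℤ.%ℕ n) ≡ (t ℤ./ℕ n) * + n
  quotient = trans (cong (_- + (t ℤ.%ℕ n)) (ℤDM.a≡a%ℕn+[a/ℕn]*n t n)) (m+n-m≡n (+ (t ℤ.%ℕ n)) ((t ℤ./ℕ n) * + n))

4∣2-x-y⇒x+y≡2 : ∀ {x y} → (x ≡ + 0) ⊎ (x ≡ + 2) → (y ≡ + 0) ⊎ (y ≡ + 2) → + 4 ∣ + 2 - (x + y) → x + y ≡ + 2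
4∣2-x-y⇒x+y≡2 (inj₁ refl) (inj₁ refl) 4∣2 with ℕD.∣⇒≤ 4∣2
... | s≤s (s≤s ())
4∣2-x-y⇒x+y≡2 (inj₁ refl) (inj₂ refl) _ = refl
4∣2-x-y⇒x+y≡2 (inj₂ refl) (inj₁ refl) _ = refl
4∣2-x-y⇒x+y≡2 (inj₂ refl) (inj₂ refl) 4∣-2 with ℕD.∣⇒≤ 4∣-2
... | s≤s (s≤s ())

pos-∸-suc : ∀ n k → k < n → + (n ℕ.∸ suc k) ≡ (+ n - + 1) - + k
pos-∸-suc n k k<n = begin
  + (n ℕ.∸ suc k)                     ≡⟨ m+n-n≡m (+ (n ℕ.∸ suc k)) (+ suc k) ⟨
  (+ (n ℕ.∸ suc k) + + suc k) - + suc k ≡⟨ cong (λ t → + t - + suc k) (ℕP.m∸n+n≡m k<n) ⟩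
  + n - + suc k                       ≡⟨ cong (λ t → + n - t) (ℤP.pos-+ 1 k) ⟩
  + n - (+ 1 + + k)                   ≡⟨ regroup (+ n) (+ k) ⟩
  (+ n - + 1) - + k                   ∎
  where
  open ≡-Reasoning
  regroup : ∀ a b → a - (+ 1 + b) ≡ (a - + 1) - b
  regroup = solve-∀

-- Functions on ℤ of period n and their sums over one period

module Periodic (n : ℕ) {{_ : NonZero n}} where

  N : ℤ
  N = + n

  Periodic : (ℤ → ℤ) → Set
  Periodic f = ∀ a b → N ∣ a - b → f a ≡ f b

  periodic-translate : ∀ {f} → Periodic f → ∀ c → Periodic (λ t → f (t + c))
  periodic-translate p c a b d = p _ _ (subst (N ∣_) (sym (shift a b c)) d)
    where
    shift : ∀ a b c → (a + c) - (b + c) ≡ a - b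
    shift = solve-∀

  periodic-reflect : ∀ {f} → Periodic f → ∀ c → Periodic (λ t → f (c - t))
  periodic-reflect p c a b d = p _ _ (subst (N ∣_) (sym (reflect a b c)) (∣m⇒∣-m {N} {a - b} d))
    where
    reflect : ∀ a b c → (c - a) - (c - b) ≡ - (a - b)
    reflect = solve-∀

  periodic-+ : ∀ {f g} → Periodic f → Periodic g → Periodic (λ t → f t + g t)
  periodic-+ p q a b d = cong₂ _+_ (p a b d) (q a b d)

  periodic-* : ∀ {f g} → Periodic f → Periodic g → Periodic (λ t → f t * g t)
  periodic-* p q a b d = cong₂ _*_ (p a b d) (q a b d)

  ∑ₙ : (ℤ → ℤ) → ℤ
  ∑ₙ f = ∑ n (λ k → f (+ k))

  ∑ₙ-cong : ∀ {f g} → (∀ t → f t ≡ g t) → ∑ₙ f ≡ ∑ₙ g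
  ∑ₙ-cong e = ∑-cong n (λ k → e (+ k))

  ∑ₙ-+ : ∀ f g → ∑ₙ (λ t → f t + g t) ≡ ∑ₙ f + ∑ₙ g
  ∑ₙ-+ f g = ∑-+ n _ _

  ∑ₙ-neg : ∀ f → ∑ₙ (λ t → - f t) ≡ - ∑ₙ f
  ∑ₙ-neg f = ∑-neg n _

  ∑ₙ-- : ∀ f g → ∑ₙ (λ t → f t - g t) ≡ ∑ₙ f - ∑ₙ g
  ∑ₙ-- f g = trans (∑ₙ-+ f (λ t → - g t)) (cong (_+_ (∑ₙ f)) (∑ₙ-neg g))

  ∑ₙ-*ˡ : ∀ c f → ∑ₙ (λ t → c * f t) ≡ c * ∑ₙ f
  ∑ₙ-*ˡ c f = ∑-*ˡ n c _

  ∑ₙ-const : ∀ c → ∑ₙ (λ _ → c) ≡ N * c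
  ∑ₙ-const = ∑-const n

  ∑ₙ-1 : ∑ₙ (λ _ → + 1) ≡ N
  ∑ₙ-1 = trans (∑ₙ-const (+ 1)) (ℤP.*-identityʳ N)

  ∑ₙ-swap : ∀ (f : ℤ → ℤ → ℤ) → ∑ₙ (λ s → ∑ₙ (f s)) ≡ ∑ₙ (λ t → ∑ₙ (λ s → f s t))
  ∑ₙ-swap f = ∑-swap n n (λ i j → f (+ i) (+ j))

  ∑ₙ-translate-1 : ∀ f → Periodic f → ∑ₙ (λ t → f (t + + 1)) ≡ ∑ₙ f
  ∑ₙ-translate-1 f p = begin
    ∑ n (λ k → f (+ k + + 1))   ≡⟨ ∑-cong n (λ k → cong (f ∘ +_) (ℕP.+-comm k 1)) ⟩
    ∑ n (λ k → f (+ suc k))     ≡⟨ +-cancelˡ (f (+ 0)) _ _ rotate ⟩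
    ∑ n (λ k → f (+ k))         ∎
    where
    open ≡-Reasoning
    f0≡fn : f (+ 0) ≡ f N
    f0≡fn = p _ _ (subst (N ∣_) (sym (ℤP.+-identityˡ (- N))) (∣m⇒∣-m {N} {N} ℕD.∣-refl))
    rotate : f (+ 0) + ∑ n (λ k → f (+ suc k)) ≡ f (+ 0) + ∑ₙ f
    rotate = begin
      ∑ (suc n) (f ∘ +_)      ≡⟨ ∑-snoc n (f ∘ +_) ⟩
      ∑ₙ f + f N              ≡⟨ cong (_+_ (∑ₙ f)) f0≡fn ⟨
      ∑ₙ f + f (+ 0)          ≡⟨ ℤP.+-comm (∑ₙ f) _ ⟩
      f (+ 0) + ∑ₙ f          ∎

  ∑ₙ-translate-+ : ∀ f → Periodic f → ∀ m → ∑ₙ (λ t → f (t + + m)) ≡ ∑ₙ f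
  ∑ₙ-translate-+ f p zero    = ∑ₙ-cong (cong f ∘ ℤP.+-identityʳ)
  ∑ₙ-translate-+ f p (suc m) = begin
    ∑ₙ (λ t → f (t + + suc m))      ≡⟨ ∑ₙ-cong (λ t → cong f (assoc t (+ m))) ⟩
    ∑ₙ (λ t → f ((t + + 1) + + m))  ≡⟨ ∑ₙ-translate-1 (λ t → f (t + + m)) (periodic-translate p (+ m)) ⟩
    ∑ₙ (λ t → f (t + + m))          ≡⟨ ∑ₙ-translate-+ f p m ⟩
    ∑ₙ f                            ∎
    where
    open ≡-Reasoning
    assoc : ∀ t x → t + (+ 1 + x) ≡ (t + + 1) + x
    assoc = solve-∀

  ∑ₙ-translate-- : ∀ f → Periodic f → ∀ m → ∑ₙ (λ t → f (t - + m)) ≡ ∑ₙ f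
  ∑ₙ-translate-- f p zero    = ∑ₙ-cong (cong f ∘ ℤP.+-identityʳ)
  ∑ₙ-translate-- f p (suc m) = begin
    ∑ₙ (λ t → f (t - + suc m))            ≡⟨ ∑ₙ-translate-1 (λ t → f (t - + suc m)) (periodic-translate p (- + suc m)) ⟨
    ∑ₙ (λ t → f ((t + + 1) - + suc m))    ≡⟨ ∑ₙ-cong (λ t → cong f (cancel t (+ m))) ⟩
    ∑ₙ (λ t → f (t - + m))                ≡⟨ ∑ₙ-translate-- f p m ⟩
    ∑ₙ f                                  ∎
    where
    open ≡-Reasoning
    cancel : ∀ t x → (t + + 1) - (+ 1 + x) ≡ t - x
    cancel = solve-∀

  ∑ₙ-translate : ∀ f → Periodic f → ∀ c → ∑ₙ (λ t → f (t + c)) ≡ ∑ₙ f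
  ∑ₙ-translate f p (+ m)    = ∑ₙ-translate-+ f p m
  ∑ₙ-translate f p -[1+ m ] = ∑ₙ-translate-- f p (suc m)

  ∑ₙ-negate : ∀ f → Periodic f → ∑ₙ (λ t → f (- t)) ≡ ∑ₙ f
  ∑ₙ-negate f p = begin
    ∑ n (λ k → f (- + k))                    ≡⟨ ∑-reverse n (λ k → f (- + k)) ⟩
    ∑ n (λ k → f (- + (n ℕ.∸ suc k)))        ≡⟨ ∑-cong< n (λ k k<n → cong f (trans (cong -_ (pos-∸-suc n k k<n)) (negate N (+ k)))) ⟩
    ∑ₙ (λ t → f (t + (+ 1 - N)))             ≡⟨ ∑ₙ-translate f p (+ 1 - N) ⟩
    ∑ₙ f                                     ∎
    where
    open ≡-Reasoning
    negate : ∀ a b → - ((a - + 1) - b) ≡ b + (+ 1 - a)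
    negate = solve-∀

  ∑ₙ-reflect : ∀ f → Periodic f → ∀ c → ∑ₙ (λ t → f (c - t)) ≡ ∑ₙ f
  ∑ₙ-reflect f p c = begin
    ∑ₙ (λ t → f (c - t))     ≡⟨ ∑ₙ-negate (λ u → f (c + u)) (λ a b d → p _ _ (subst (N ∣_) (shift a b c) d)) ⟩
    ∑ₙ (λ t → f (c + t))     ≡⟨ ∑ₙ-cong (λ t → cong f (ℤP.+-comm c t)) ⟩
    ∑ₙ (λ t → f (t + c))     ≡⟨ ∑ₙ-translate f p c ⟩
    ∑ₙ f                     ∎
    where
    open ≡-Reasoning
    shift : ∀ a b c → a - b ≡ (c + a) - (c + b)
    shift = solve-∀

  ∑ₙ-reindex-translate : ∀ F → Periodic F → ∀ c G → (∀ k → G k ≡ F (k + c)) → ∑ₙ G ≡ ∑ₙ F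
  ∑ₙ-reindex-translate F p c G e = trans (∑ₙ-cong e) (∑ₙ-translate F p c)

  ∑ₙ-reindex-reflect : ∀ F → Periodic F → ∀ c G → (∀ k → G k ≡ F (c - k)) → ∑ₙ G ≡ ∑ₙ F
  ∑ₙ-reindex-reflect F p c G e = trans (∑ₙ-cong e) (∑ₙ-reflect F p c)

  N∤small : ∀ m → 0 < m → m < n → ¬ N ∣ + m
  N∤small (suc m) _ m<n N∣m = ℕP.<⇒≱ m<n (ℕD.∣⇒≤ N∣m)

  N∤-below : ∀ k a → k < a → a < n → ¬ N ∣ + k - + a
  N∤-below k a k<a a<n N∣k-a = N∤small (a ℕ.∸ k) (ℕP.m<n⇒0<n∸m k<a) (ℕP.≤-<-trans (ℕP.m∸n≤m a k) a<n)
    (subst (n ℕD.∣_) (trans (cong ∣_∣ (trans (ℤP.m-n≡m⊖n k a) (ℤP.⊖-< k<a))) (ℤP.∣-i∣≡∣i∣ (+ (a ℕ.∸ k)))) N∣k-a)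

  N∤-distinct : ∀ k a → k < n → a < n → k ≢ a → ¬ N ∣ + k - + a
  N∤-distinct k a k<n a<n k≢a N∣k-a with ℕP.<-cmp k a
  ... | tri< k<a _ _ = N∤-below k a k<a a<n N∣k-a
  ... | tri≈ _ k≡a _ = k≢a k≡a
  ... | tri> _ _ a<k = N∤-below a k a<k k<n (subst (N ∣_) (flip (+ k) (+ a)) (∣m⇒∣-m {N} {+ k - + a} N∣k-a))
    where
    flip : ∀ x y → - (x - y) ≡ y - x
    flip = solve-∀

  δ : ℤ → ℤ
  δ a with N ∣? a
  ... | yes _ = + 1
  ... | no  _ = + 0

  δ-yes : ∀ {a} → N ∣ a → δ a ≡ + 1
  δ-yes {a} N∣a with N ∣? a
  ... | yes _   = refl
  ... | no  N∤a = ⊥-elim (N∤a N∣a)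

  δ-no : ∀ {a} → ¬ N ∣ a → δ a ≡ + 0
  δ-no {a} N∤a with N ∣? a
  ... | yes N∣a = ⊥-elim (N∤a N∣a)
  ... | no  _   = refl

  δ-cong : ∀ {a b} → (N ∣ a → N ∣ b) → (N ∣ b → N ∣ a) → δ a ≡ δ b
  δ-cong {a} {b} a⇒b b⇒a with N ∣? a
  ... | yes N∣a = sym (δ-yes (a⇒b N∣a))
  ... | no  N∤a = sym (δ-no (N∤a ∘ b⇒a))

  δ-neg : ∀ a → δ (- a) ≡ δ a
  δ-neg a = δ-cong (∣-m⇒∣m {N} {a}) (∣m⇒∣-m {N} {a})

  δ-swap : ∀ a b → δ (a - b) ≡ δ (b - a)
  δ-swap a b = trans (cong δ (flip a b)) (δ-neg (b - a))
    where
    flip : ∀ a b → a - b ≡ - (b - a)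
    flip = solve-∀

  δ-periodic : Periodic δ
  δ-periodic a b N∣a-b = δ-cong
    (λ N∣a → subst (N ∣_) (a-[a-b] a b) (∣m∣n⇒∣m-n {N} {a} {a - b} N∣a N∣a-b))
    (λ N∣b → subst (N ∣_) (b+[a-b] a b) (∣m∣n⇒∣m+n {N} {b} {a - b} N∣b N∣a-b))
    where
    a-[a-b] : ∀ a b → a - (a - b) ≡ b
    a-[a-b] = solve-∀
    b+[a-b] : ∀ a b → b + (a - b) ≡ a
    b+[a-b] = solve-∀

  δ-0 : ∀ a → δ (a - + 0) ≡ δ a
  δ-0 a = cong δ (ℤP.+-identityʳ a)

  ∑ₙ-δ : ∀ a → ∑ₙ (λ y → δ (y - a)) ≡ + 1
  ∑ₙ-δ a = trans (∑-single n (λ k → δ (+ k - a)) r r<n off) (δ-yes N∣r-a)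
    where
    r = a ℤ.%ℕ n
    r<n = ℤDM.n%ℕd<d a n
    N∣a-r : N ∣ a - + r
    N∣a-r = n∣t-t%n a n
    N∣r-a : N ∣ + r - a
    N∣r-a = subst (N ∣_) (flip a (+ r)) (∣m⇒∣-m {N} {a - + r} N∣a-r)
      where flip : ∀ x y → - (x - y) ≡ y - x
            flip = solve-∀
    off : ∀ k → k < n → k ≢ r → δ (+ k - a) ≡ + 0
    off k k<n k≢r = δ-no λ N∣k-a → N∤-distinct k r k<n r<n k≢r
      (subst (N ∣_) (ℤP.+-minus-telescope (+ k) a (+ r)) (∣m∣n⇒∣m+n {N} {+ k - a} {a - + r} N∣k-a N∣a-r))

  ∑ₙ-sift : ∀ f → Periodic f → ∀ a → ∑ₙ (λ k → f k * δ (k - a)) ≡ f a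
  ∑ₙ-sift f pf a = begin
    ∑ₙ (λ k → f k * δ (k - a))   ≡⟨ ∑ₙ-cong pointwise ⟩
    ∑ₙ (λ k → f a * δ (k - a))   ≡⟨ ∑ₙ-*ˡ (f a) (λ k → δ (k - a)) ⟩
    f a * ∑ₙ (λ k → δ (k - a))   ≡⟨ cong (f a *_) (∑ₙ-δ a) ⟩
    f a * + 1                    ≡⟨ ℤP.*-identityʳ (f a) ⟩
    f a                          ∎
    where
    open ≡-Reasoning
    pointwise : ∀ k → f k * δ (k - a) ≡ f a * δ (k - a)
    pointwise k with N ∣? (k - a)
    ... | yes N∣k-a = cong (_* + 1) (pf k a N∣k-a)
    ... | no  _     = trans (ℤP.*-zeroʳ (f k)) (sym (ℤP.*-zeroʳ (f a)))

  ∑ₙ-δ-0 : ∑ₙ δ ≡ + 1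
  ∑ₙ-δ-0 = trans (∑ₙ-cong (sym ∘ δ-0)) (∑ₙ-δ (+ 0))

-- Circulant matrices

module Circulants (n : ℕ) {{_ : NonZero n}} where
  open Periodic n

  ι : Fin n → ℤ
  ι k = + toℕ k

  circulant : (ℤ → ℤ) → Mat n
  circulant f i j = f (ι j - ι i)

  last : ℤ
  last = N - + 1

  ι-opposite : ∀ k → ι (opposite k) ≡ last - ι k
  ι-opposite k = trans (cong +_ (FinP.opposite-prop k)) (pos-∸-suc n (toℕ k) (FinP.toℕ<n k))

  N∤ι-ι : ∀ {i j} → i ≢ j → ¬ N ∣ ι i - ι j
  N∤ι-ι {i} {j} i≢j = N∤-distinct (toℕ i) (toℕ j) (FinP.toℕ<n i) (FinP.toℕ<n j) (i≢j ∘ FinP.toℕ-injective)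

  Entries : Set
  Entries = ℤ → ℤ → ℤ

  record HasEntries (M : Mat n) (e : Entries) : Set where
    constructor hasEntries
    field entry : ∀ i k → M i k ≡ e (ι i) (ι k)
  open HasEntries

  -- The entries of C, C ⊗ R and Cᵀ ⊗ R for C = circulant f.
  circᵉ revᵉ trevᵉ : (ℤ → ℤ) → Entries
  circᵉ  f i k = f (k - i)
  revᵉ   f i k = f ((last - k) - i)
  trevᵉ  f i k = f (i - (last - k))

  module _ {M : Mat n} {f : ℤ → ℤ} (M≐ : M ≐ circulant f) where

    hasEntries-circᵉ : HasEntries M (circᵉ f)
    hasEntries-circᵉ = hasEntries M≐

    hasEntries-revᵉ : HasEntries (M ⊗ R) (revᵉ f)
    hasEntries-revᵉ = hasEntries λ i k → trans (⊗R-entry M i k) (trans (M≐ i (opposite k)) (cong (λ t → f (t - ι i)) (ι-opposite k)))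

    hasEntries-trevᵉ : HasEntries ((M ᵀ) ⊗ R) (trevᵉ f)
    hasEntries-trevᵉ = hasEntries λ i k → trans (⊗R-entry (M ᵀ) i k) (trans (M≐ (opposite k) i) (cong (λ t → f (ι i - t)) (ι-opposite k)))

  corr : Entries → Entries → Entries
  corr e e′ i j = ∑ₙ (λ k → e i k * e′ j k)

  ⟪⟫-corr : ∀ {M M′ e e′} → HasEntries M e → HasEntries M′ e′ → ∀ i j → ⟪ M , M′ ⟫ i j ≡ corr e e′ (ι i) (ι j)
  ⟪⟫-corr {e = e} {e′} hM hM′ i j =
    trans (Σᶠ-cong (λ k → cong₂ _*_ (entry hM i k) (entry hM′ j k))) (Σᶠ≡∑ n (λ m → e (ι i) (+ m) * e′ (ι j) (+ m)))

  private
    periodic-circᵉ : ∀ {h} → Periodic h → ∀ i → Periodic (circᵉ h i)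
    periodic-circᵉ p i = periodic-translate p (- i)

    periodic-revᵉ : ∀ {h} → Periodic h → ∀ i → Periodic (revᵉ h i)
    periodic-revᵉ p i = periodic-reflect (periodic-translate p (- i)) last

    periodic-trevᵉ : ∀ {h} → Periodic h → ∀ i → Periodic (trevᵉ h i)
    periodic-trevᵉ p i = periodic-reflect (periodic-reflect p i) last

    rev-by-translate : ∀ L k i j → (L - k) - j ≡ (L - (k + (j - i))) - i
    rev-by-translate = solve-∀
    circ-by-translate : ∀ k i j → k - i ≡ (k + (j - i)) - j
    circ-by-translate = solve-∀
    trev-by-translate : ∀ L k i j → j - (L - k) ≡ i - (L - (k + (j - i)))
    trev-by-translate = solve-∀
    rev-by-reflect : ∀ L k i j → j - (L - k) ≡ (L - (((L + L) - i - j) - k)) - i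
    rev-by-reflect = solve-∀
    trev-by-reflect : ∀ L k i j → (L - k) - i ≡ j - (L - (((L + L) - i - j) - k))
    trev-by-reflect = solve-∀
    rev-trev-by-reflect : ∀ L k i j → (L - k) - j ≡ i - (L - (((L + L) - i - j) - k))
    rev-trev-by-reflect = solve-∀
    trev-circ₁ : ∀ L k i j → i - (L - k) ≡ (k + ((i + j) - L)) - j
    trev-circ₁ = solve-∀
    trev-circ₂ : ∀ L k i j → j - (L - k) ≡ (k + ((i + j) - L)) - i
    trev-circ₂ = solve-∀

  -- Each identity is a substitution k ↦ k + c or k ↦ c - k in the sum over one period.
  module _ {f g : ℤ → ℤ} (pf : Periodic f) (pg : Periodic g) (i j : ℤ) where

    corr-circᵉ-revᵉ : corr (circᵉ f) (revᵉ g) i j ≡ corr (revᵉ g) (circᵉ f) i j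
    corr-circᵉ-revᵉ =
      ∑ₙ-reindex-translate (λ k → revᵉ g i k * circᵉ f j k) (periodic-* (periodic-revᵉ pg i) (periodic-circᵉ pf j))
        (j - i) (λ k → circᵉ f i k * revᵉ g j k)
        (λ k → trans (ℤP.*-comm (f (k - i)) _) (cong₂ _*_ (cong g (rev-by-translate last k i j)) (cong f (circ-by-translate k i j))))

    corr-circᵉ-trevᵉ : corr (circᵉ f) (trevᵉ g) i j ≡ corr (trevᵉ g) (circᵉ f) i j
    corr-circᵉ-trevᵉ =
      ∑ₙ-reindex-translate (λ k → trevᵉ g i k * circᵉ f j k) (periodic-* (periodic-trevᵉ pg i) (periodic-circᵉ pf j))
        (j - i) (λ k → circᵉ f i k * trevᵉ g j k)
        (λ k → trans (ℤP.*-comm (f (k - i)) _) (cong₂ _*_ (cong g (trev-by-translate last k i j)) (cong f (circ-by-translate k i j))))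

    corr-revᵉ-trevᵉ : corr (revᵉ f) (trevᵉ g) i j ≡ corr (revᵉ g) (trevᵉ f) i j
    corr-revᵉ-trevᵉ =
      ∑ₙ-reindex-reflect (λ k → revᵉ g i k * trevᵉ f j k) (periodic-* (periodic-revᵉ pg i) (periodic-trevᵉ pf j))
        ((last + last) - i - j) (λ k → revᵉ f i k * trevᵉ g j k)
        (λ k → trans (ℤP.*-comm (f ((last - k) - i)) _) (cong₂ _*_ (cong g (rev-by-reflect last k i j)) (cong f (trev-by-reflect last k i j))))

    corr-revᵉ-revᵉ : corr (revᵉ f) (revᵉ g) i j ≡ corr (trevᵉ g) (trevᵉ f) i j
    corr-revᵉ-revᵉ =
      ∑ₙ-reindex-reflect (λ k → trevᵉ g i k * trevᵉ f j k) (periodic-* (periodic-trevᵉ pg i) (periodic-trevᵉ pf j))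
        ((last + last) - i - j) (λ k → revᵉ f i k * revᵉ g j k)
        (λ k → trans (ℤP.*-comm (f ((last - k) - i)) _) (cong₂ _*_ (cong g (rev-trev-by-reflect last k i j)) (cong f (trev-by-reflect last k i j))))

  module _ {f : ℤ → ℤ} (pf : Periodic f) (i j : ℤ) where

    corr-revᵉ : corr (revᵉ f) (revᵉ f) i j ≡ corr (circᵉ f) (circᵉ f) i j
    corr-revᵉ =
      ∑ₙ-reindex-reflect (λ k → circᵉ f i k * circᵉ f j k) (periodic-* (periodic-circᵉ pf i) (periodic-circᵉ pf j))
        last (λ k → revᵉ f i k * revᵉ f j k) (λ _ → refl)

    corr-trevᵉ : corr (trevᵉ f) (trevᵉ f) i j ≡ corr (circᵉ f) (circᵉ f) i j
    corr-trevᵉ =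
      ∑ₙ-reindex-translate (λ k → circᵉ f i k * circᵉ f j k) (periodic-* (periodic-circᵉ pf i) (periodic-circᵉ pf j))
        ((i + j) - last) (λ k → trevᵉ f i k * trevᵉ f j k)
        (λ k → trans (ℤP.*-comm (f (i - (last - k))) _) (cong₂ _*_ (cong f (trev-circ₂ last k i j)) (cong f (trev-circ₁ last k i j))))

  ⟪⟫-via-corr : ∀ {M₁ M₂ M₃ M₄ e₁ e₂ e₃ e₄} →
    HasEntries M₁ e₁ → HasEntries M₂ e₂ → HasEntries M₃ e₃ → HasEntries M₄ e₄ →
    (∀ i j → corr e₁ e₂ i j ≡ corr e₃ e₄ i j) → ∀ i j → ⟪ M₁ , M₂ ⟫ i j ≡ ⟪ M₃ , M₄ ⟫ i j
  ⟪⟫-via-corr h₁ h₂ h₃ h₄ e i j = trans (⟪⟫-corr h₁ h₂ i j) (trans (e (ι i) (ι j)) (sym (⟪⟫-corr h₃ h₄ i j)))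

module FirstRow (m : ℕ) where
  open Periodic (suc m)
  open Circulants (suc m)

  residue : ℤ → Fin (suc m)
  residue t = Fin.fromℕ< (ℤDM.n%ℕd<d t (suc m))

  residue-∣ : ∀ t → N ∣ t - ι (residue t)
  residue-∣ t = subst (λ r → N ∣ t - + r) (sym (FinP.toℕ-fromℕ< _)) (n∣t-t%n t (suc m))

  firstRow : Mat (suc m) → ℤ → ℤ
  firstRow X t = X 0F (residue t)

  module _ {X : Mat (suc m)} (cX : Circulant X) where

    circulant-firstRow : X ≐ circulant (firstRow X)
    circulant-firstRow i j = cX i j 0F (residue t) (subst (λ u → N ∣ t - u) (sym (ℤP.+-identityʳ _)) (residue-∣ t))
      where t = ι j - ι i

    periodic-firstRow : Periodic (firstRow X)
    periodic-firstRow s t N∣s-t = cX 0F (residue s) 0F (residue t)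
      (subst (N ∣_) (sym (regroup s t (ι (residue s)) (ι (residue t))))
             (∣m∣n⇒∣m+n {N} {(s - t) - (s - ι (residue s))} {t - ι (residue t)}
               (∣m∣n⇒∣m-n {N} {s - t} {s - ι (residue s)} N∣s-t (residue-∣ s)) (residue-∣ t)))
      where
      regroup : ∀ s t u v → (u - + 0) - (v - + 0) ≡ ((s - t) - (s - u)) + (t - v)
      regroup = solve-∀

-- The generalised propus array

propusBlocks : ∀ {n} → Mat n → Mat n → Mat n → Fin 4 → Fin 4 → Mat n
propusBlocks A B D = arr
  A          (B ⊗ R)          (B ⊗ R)          (D ⊗ R)
  (B ⊗ R)    ((D ᵀ) ⊗ R)      (neg A)          (neg ((B ᵀ) ⊗ R))
  (B ⊗ R)    (neg A)          (neg ((D ᵀ) ⊗ R)) ((B ᵀ) ⊗ R)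
  (D ⊗ R)    (neg ((B ᵀ) ⊗ R)) ((B ᵀ) ⊗ R)     (neg A)

genPropus-IsPM1 : ∀ {n} {A B D : Mat n} → IsPM1 A → IsPM1 B → IsPM1 D → IsPM1 (genPropus A B D)
genPropus-IsPM1 {A = A} {B} {D} ±A ±B ±D = block4-IsPM1 (propusBlocks A B D) blocks
  where
  ±BR = IsPM1-⊗R ±B
  ±DR = IsPM1-⊗R ±D
  ±BᵀR = IsPM1-⊗R (IsPM1-ᵀ ±B)
  ±DᵀR = IsPM1-⊗R (IsPM1-ᵀ ±D)
  blocks : ∀ r r′ → IsPM1 (propusBlocks A B D r r′)
  blocks 0F 0F = ±A
  blocks 0F 1F = ±BR
  blocks 0F 2F = ±BR
  blocks 0F 3F = ±DR
  blocks 1F 0F = ±BR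
  blocks 1F 1F = ±DᵀR
  blocks 1F 2F = IsPM1-neg ±A
  blocks 1F 3F = IsPM1-neg ±BᵀR
  blocks 2F 0F = ±BR
  blocks 2F 1F = IsPM1-neg ±A
  blocks 2F 2F = IsPM1-neg ±DᵀR
  blocks 2F 3F = ±BᵀR
  blocks 3F 0F = ±DR
  blocks 3F 1F = IsPM1-neg ±BᵀR
  blocks 3F 2F = ±BᵀR
  blocks 3F 3F = IsPM1-neg ±A

module GeneralisedPropus (n : ℕ) {{_ : NonZero n}} {A B D : Mat n} {a b d : ℤ → ℤ}
  (pa : Periodic.Periodic n a) (pb : Periodic.Periodic n b) (pd : Periodic.Periodic n d)
  (A≐ : A ≐ Circulants.circulant n a) (B≐ : B ≐ Circulants.circulant n b) (D≐ : D ≐ Circulants.circulant n d)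
  where

  open Circulants n

  BR DR BᵀR DᵀR : Mat n
  BR = B ⊗ R
  DR = D ⊗ R
  BᵀR = (B ᵀ) ⊗ R
  DᵀR = (D ᵀ) ⊗ R

  blocks : Fin 4 → Fin 4 → Mat n
  blocks = propusBlocks A B D

  private
    hA = hasEntries-circᵉ {f = a} A≐
    hB = hasEntries-circᵉ {f = b} B≐
    hD = hasEntries-circᵉ {f = d} D≐
    hBR = hasEntries-revᵉ {f = b} B≐
    hDR = hasEntries-revᵉ {f = d} D≐
    hBᵀR = hasEntries-trevᵉ {f = b} B≐
    hDᵀR = hasEntries-trevᵉ {f = d} D≐

  ⟪A,BR⟫ : ∀ i j → ⟪ A , BR ⟫ i j ≡ ⟪ BR , A ⟫ i j
  ⟪A,BR⟫ = ⟪⟫-via-corr hA hBR hBR hA (corr-circᵉ-revᵉ pa pb)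

  ⟪A,DR⟫ : ∀ i j → ⟪ A , DR ⟫ i j ≡ ⟪ DR , A ⟫ i j
  ⟪A,DR⟫ = ⟪⟫-via-corr hA hDR hDR hA (corr-circᵉ-revᵉ pa pd)

  ⟪A,BᵀR⟫ : ∀ i j → ⟪ A , BᵀR ⟫ i j ≡ ⟪ BᵀR , A ⟫ i j
  ⟪A,BᵀR⟫ = ⟪⟫-via-corr hA hBᵀR hBᵀR hA (corr-circᵉ-trevᵉ pa pb)

  ⟪A,DᵀR⟫ : ∀ i j → ⟪ A , DᵀR ⟫ i j ≡ ⟪ DᵀR , A ⟫ i j
  ⟪A,DᵀR⟫ = ⟪⟫-via-corr hA hDᵀR hDᵀR hA (corr-circᵉ-trevᵉ pa pd)

  ⟪BR,DᵀR⟫ : ∀ i j → ⟪ BR , DᵀR ⟫ i j ≡ ⟪ DR , BᵀR ⟫ i j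
  ⟪BR,DᵀR⟫ = ⟪⟫-via-corr hBR hDᵀR hDR hBᵀR (corr-revᵉ-trevᵉ pb pd)

  ⟪BR,DR⟫ : ∀ i j → ⟪ BR , DR ⟫ i j ≡ ⟪ DᵀR , BᵀR ⟫ i j
  ⟪BR,DR⟫ = ⟪⟫-via-corr hBR hDR hDᵀR hBᵀR (corr-revᵉ-revᵉ pb pd)

  ⟪BR,BR⟫ : ∀ i j → ⟪ BR , BR ⟫ i j ≡ ⟪ B , B ⟫ i j
  ⟪BR,BR⟫ = ⟪⟫-via-corr hBR hBR hB hB (corr-revᵉ pb)

  ⟪DR,DR⟫ : ∀ i j → ⟪ DR , DR ⟫ i j ≡ ⟪ D , D ⟫ i j
  ⟪DR,DR⟫ = ⟪⟫-via-corr hDR hDR hD hD (corr-revᵉ pd)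

  ⟪BᵀR,BᵀR⟫ : ∀ i j → ⟪ BᵀR , BᵀR ⟫ i j ≡ ⟪ B , B ⟫ i j
  ⟪BᵀR,BᵀR⟫ = ⟪⟫-via-corr hBᵀR hBᵀR hB hB (corr-trevᵉ pb)

  ⟪DᵀR,DᵀR⟫ : ∀ i j → ⟪ DᵀR , DᵀR ⟫ i j ≡ ⟪ D , D ⟫ i j
  ⟪DᵀR,DᵀR⟫ = ⟪⟫-via-corr hDᵀR hDᵀR hD hD (corr-trevᵉ pd)

  G : Mat n
  G = (⟪ A , A ⟫ ⊕ ((+ 2) · ⟪ B , B ⟫)) ⊕ ⟪ D , D ⟫

  blockGram : Fin 4 → Fin 4 → Mat n
  blockGram r r′ i j = Σᶠ (λ c → ⟪ blocks r c , blocks r′ c ⟫ i j)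

  private
    blockGram-≡ : ∀ r r′ i j {w x y z} →
      ⟪ blocks r 0F , blocks r′ 0F ⟫ i j ≡ w → ⟪ blocks r 1F , blocks r′ 1F ⟫ i j ≡ x →
      ⟪ blocks r 2F , blocks r′ 2F ⟫ i j ≡ y → ⟪ blocks r 3F , blocks r′ 3F ⟫ i j ≡ z →
      blockGram r r′ i j ≡ w + (x + (y + (z + + 0)))
    blockGram-≡ r r′ i j refl refl refl refl = refl

    cancel₁ : ∀ x y → x + (y + (- x + (- y + + 0))) ≡ + 0
    cancel₁ = solve-∀
    cancel₂ : ∀ x y → x + (- x + (- y + (y + + 0))) ≡ + 0
    cancel₂ = solve-∀
    cancel₃ : ∀ x y → x + (- y + (y + (- x + + 0))) ≡ + 0
    cancel₃ = solve-∀

    collect₀ : ∀ a b d → a + (b + (b + (d + + 0))) ≡ (a + + 2 * b) + d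
    collect₀ = solve-∀
    collect₁ : ∀ a b d → b + (d + (a + (b + + 0))) ≡ (a + + 2 * b) + d
    collect₁ = solve-∀
    collect₂ : ∀ a b d → b + (a + (d + (b + + 0))) ≡ (a + + 2 * b) + d
    collect₂ = solve-∀
    collect₃ : ∀ a b d → d + (b + (b + (a + + 0))) ≡ (a + + 2 * b) + d
    collect₃ = solve-∀

  blockGram-diagonal : ∀ r i j → blockGram r r i j ≡ G i j
  blockGram-diagonal 0F i j = trans
    (blockGram-≡ 0F 0F i j
      refl
      (⟪BR,BR⟫ i j)
      (⟪BR,BR⟫ i j)
      (⟪DR,DR⟫ i j))
    (collect₀ (⟪ A , A ⟫ i j) (⟪ B , B ⟫ i j) (⟪ D , D ⟫ i j))
  blockGram-diagonal 1F i j = trans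
    (blockGram-≡ 1F 1F i j
      (⟪BR,BR⟫ i j)
      (⟪DᵀR,DᵀR⟫ i j)
      (⟪neg,neg⟫ A A i j)
      (trans (⟪neg,neg⟫ BᵀR BᵀR i j) (⟪BᵀR,BᵀR⟫ i j)))
    (collect₁ (⟪ A , A ⟫ i j) (⟪ B , B ⟫ i j) (⟪ D , D ⟫ i j))
  blockGram-diagonal 2F i j = trans
    (blockGram-≡ 2F 2F i j
      (⟪BR,BR⟫ i j)
      (⟪neg,neg⟫ A A i j)
      (trans (⟪neg,neg⟫ DᵀR DᵀR i j) (⟪DᵀR,DᵀR⟫ i j))
      (⟪BᵀR,BᵀR⟫ i j))
    (collect₂ (⟪ A , A ⟫ i j) (⟪ B , B ⟫ i j) (⟪ D , D ⟫ i j))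
  blockGram-diagonal 3F i j = trans
    (blockGram-≡ 3F 3F i j
      (⟪DR,DR⟫ i j)
      (trans (⟪neg,neg⟫ BᵀR BᵀR i j) (⟪BᵀR,BᵀR⟫ i j))
      (⟪BᵀR,BᵀR⟫ i j)
      (⟪neg,neg⟫ A A i j))
    (collect₃ (⟪ A , A ⟫ i j) (⟪ B , B ⟫ i j) (⟪ D , D ⟫ i j))

  blockGram-comm : ∀ r r′ i j → blockGram r r′ i j ≡ blockGram r′ r j i
  blockGram-comm r r′ i j = Σᶠ-cong (λ c → ⟪⟫-comm (blocks r c) (blocks r′ c) i j)

  blockGram-upper : ∀ r r′ → r Fin.< r′ → ∀ i j → blockGram r r′ i j ≡ + 0
  blockGram-upper 0F 1F _ i j = trans
    (blockGram-≡ 0F 1F i j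
      refl
      refl
      (trans (⟪,neg⟫ BR A i j) (cong -_ (sym (⟪A,BR⟫ i j))))
      (trans (⟪,neg⟫ DR BᵀR i j) (cong -_ (sym (⟪BR,DᵀR⟫ i j)))))
    (cancel₁ (⟪ A , BR ⟫ i j) (⟪ BR , DᵀR ⟫ i j))
  blockGram-upper 0F 2F _ i j = trans
    (blockGram-≡ 0F 2F i j
      refl
      (trans (⟪,neg⟫ BR A i j) (cong -_ (sym (⟪A,BR⟫ i j))))
      (⟪,neg⟫ BR DᵀR i j)
      (sym (⟪BR,DᵀR⟫ i j)))
    (cancel₂ (⟪ A , BR ⟫ i j) (⟪ BR , DᵀR ⟫ i j))
  blockGram-upper 0F 3F _ i j = trans
    (blockGram-≡ 0F 3F i j
      refl
      (⟪,neg⟫ BR BᵀR i j)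
      refl
      (trans (⟪,neg⟫ DR A i j) (cong -_ (sym (⟪A,DR⟫ i j)))))
    (cancel₃ (⟪ A , DR ⟫ i j) (⟪ BR , BᵀR ⟫ i j))
  blockGram-upper 1F 2F _ i j = trans
    (blockGram-≡ 1F 2F i j
      (⟪BR,BR⟫ i j)
      (trans (⟪,neg⟫ DᵀR A i j) (cong -_ (sym (⟪A,DᵀR⟫ i j))))
      (⟪neg,neg⟫ A DᵀR i j)
      (trans (⟪neg,⟫ BᵀR BᵀR i j) (cong -_ (⟪BᵀR,BᵀR⟫ i j))))
    (cancel₃ (⟪ B , B ⟫ i j) (⟪ A , DᵀR ⟫ i j))
  blockGram-upper 1F 3F _ i j = trans
    (blockGram-≡ 1F 3F i j
      (⟪BR,DR⟫ i j)
      (⟪,neg⟫ DᵀR BᵀR i j)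
      (⟪neg,⟫ A BᵀR i j)
      (trans (⟪neg,neg⟫ BᵀR A i j) (sym (⟪A,BᵀR⟫ i j))))
    (cancel₂ (⟪ DᵀR , BᵀR ⟫ i j) (⟪ A , BᵀR ⟫ i j))
  blockGram-upper 2F 3F _ i j = trans
    (blockGram-≡ 2F 3F i j
      (⟪BR,DR⟫ i j)
      (⟪neg,neg⟫ A BᵀR i j)
      (⟪neg,⟫ DᵀR BᵀR i j)
      (trans (⟪,neg⟫ BᵀR A i j) (cong -_ (sym (⟪A,BᵀR⟫ i j)))))
    (cancel₁ (⟪ DᵀR , BᵀR ⟫ i j) (⟪ A , BᵀR ⟫ i j))
  blockGram-upper 0F 0F ()
  blockGram-upper 1F 0F ()
  blockGram-upper 2F 0F ()
  blockGram-upper 3F 0F ()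
  blockGram-upper 1F 1F (s<s ())
  blockGram-upper 2F 1F (s<s ())
  blockGram-upper 3F 1F (s<s ())
  blockGram-upper 2F 2F (s<s (s<s ()))
  blockGram-upper 3F 2F (s<s (s<s ()))
  blockGram-upper 3F 3F (s<s (s<s (s<s ())))

  blockGram-offDiagonal : ∀ r r′ → r ≢ r′ → ∀ i j → blockGram r r′ i j ≡ + 0
  blockGram-offDiagonal r r′ r≢r′ i j with FinP.<-cmp r r′
  ... | tri< r<r′ _ _ = blockGram-upper r r′ r<r′ i j
  ... | tri≈ _ r≡r′ _ = ⊥-elim (r≢r′ r≡r′)
  ... | tri> _ _ r′<r = trans (blockGram-comm r r′ i j) (blockGram-upper r′ r r′<r j i)

  genPropus-gram : ∀ r i r′ j → ⟪ genPropus A B D , genPropus A B D ⟫ (combine r i) (combine r′ j) ≡ blockGram r r′ i j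
  genPropus-gram = block4-gram blocks

  genPropus-orthogonal : ∀ c → G ≐ (c · I) → ⟪ genPropus A B D , genPropus A B D ⟫ ≐ (c · I)
  genPropus-orthogonal c G≐cI = ∀-combine (λ r s → ⟪ genPropus A B D , genPropus A B D ⟫ r s ≡ (c · I) r s) entry
    where
    entry : ∀ r i r′ j → ⟪ genPropus A B D , genPropus A B D ⟫ (combine r i) (combine r′ j) ≡ c * I (combine r i) (combine r′ j)
    entry r i r′ j with r ≟ᶠ r′
    ... | yes refl = begin
      ⟪ genPropus A B D , genPropus A B D ⟫ (combine r i) (combine r j) ≡⟨ genPropus-gram r i r j ⟩
      blockGram r r i j                                                ≡⟨ blockGram-diagonal r i j ⟩
      G i j                                                            ≡⟨ G≐cI i j ⟩
      c * I i j                                                        ≡⟨ cong (c *_) (I-combine-≡ r i j) ⟨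
      c * I (combine r i) (combine r j)                                ∎
      where open ≡-Reasoning
    ... | no r≢r′ = begin
      ⟪ genPropus A B D , genPropus A B D ⟫ (combine r i) (combine r′ j) ≡⟨ genPropus-gram r i r′ j ⟩
      blockGram r r′ i j                                                ≡⟨ blockGram-offDiagonal r r′ r≢r′ i j ⟩
      + 0                                                               ≡⟨ ℤP.*-zeroʳ c ⟨
      c * + 0                                                           ≡⟨ cong (c *_) (I-combine-≢ i j r≢r′) ⟨
      c * I (combine r i) (combine r′ j)                                ∎
      where open ≡-Reasoning

-- Quadratic residues modulo a prime p ≡ 3 (mod 4)

module PrimeModulus (p : ℕ) {{_ : NonZero p}} (p-prime : Prime p) where
  open Periodic p

  euclid : ∀ a b → N ∣ a * b → (N ∣ a) ⊎ (N ∣ b)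
  euclid a b N∣ab = euclidsLemma ∣ a ∣ ∣ b ∣ p-prime (subst (p ℕD.∣_) (ℤP.abs-* a b) N∣ab)

  modular-inverse : ∀ w → ¬ N ∣ w → Σ ℤ λ v → N ∣ w * v - + 1
  modular-inverse w N∤w = signed (ℤP.+∣i∣≡i⊎+∣i∣≡-i w)
    where
    m = ∣ w ∣
    coprime : Coprimality.Coprime m p
    coprime (d∣w , d∣p) with prime⇒irreducible p-prime d∣p
    ... | inj₁ d≡1  = d≡1
    ... | inj₂ refl = ⊥-elim (N∤w d∣w)
    N∣yN : ∀ y → N ∣ + (y ℕ.* p)
    N∣yN y = subst (N ∣_) (sym (ℤP.pos-* y p)) (n∣m*n N (+ y))
    inverse-of-abs : Σ ℤ λ u → N ∣ + m * u - + 1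
    inverse-of-abs with Coprimality.coprime-Bézout coprime
    ... | Bézout.+- x y 1+yp≡xm = + x , subst (N ∣_) (sym (begin
      + m * + x - + 1            ≡⟨ cong (_- + 1) (trans (ℤP.*-comm (+ m) (+ x)) (sym (ℤP.pos-* x m))) ⟩
      + (x ℕ.* m) - + 1          ≡⟨ cong (λ t → + t - + 1) 1+yp≡xm ⟨
      + (1 ℕ.+ y ℕ.* p) - + 1    ≡⟨ m+n-m≡n (+ 1) (+ (y ℕ.* p)) ⟩
      + (y ℕ.* p)                ∎)) (N∣yN y)
      where open ≡-Reasoning
    ... | Bézout.-+ x y 1+xm≡yp = - + x , subst (N ∣_) (sym (begin
      + m * - + x - + 1          ≡⟨ negate (+ m) (+ x) ⟩
      - (+ 1 + + x * + m)        ≡⟨ cong (λ t → - (+ 1 + t)) (ℤP.pos-* x m) ⟨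
      - + (1 ℕ.+ x ℕ.* m)        ≡⟨ cong (λ t → - + t) 1+xm≡yp ⟩
      - + (y ℕ.* p)              ∎)) (∣m⇒∣-m {N} {+ (y ℕ.* p)} (N∣yN y))
      where
      open ≡-Reasoning
      negate : ∀ m x → m * - x - + 1 ≡ - (+ 1 + x * m)
      negate = solve-∀
    signed : (+ m ≡ w) ⊎ (+ m ≡ - w) → Σ ℤ λ v → N ∣ w * v - + 1
    signed (inj₁ e) = proj₁ inverse-of-abs , subst (λ t → N ∣ t * proj₁ inverse-of-abs - + 1) e (proj₂ inverse-of-abs)
    signed (inj₂ e) = - proj₁ inverse-of-abs , subst (N ∣_) (cong (_- + 1) (trans (cong (_* proj₁ inverse-of-abs) e)
                        (trans (sym (ℤP.neg-distribˡ-* w _)) (ℤP.neg-distribʳ-* w _)))) (proj₂ inverse-of-abs)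

module QuadraticResidues (p : ℕ) {{_ : NonZero p}} (p-prime : Prime p) (p%4≡3 : p % 4 ≡ 3) where
  open Periodic p
  open PrimeModulus p p-prime

  3≤p : 3 ℕ.≤ p
  3≤p = lemma p p%4≡3
    where
    lemma : ∀ q → q % 4 ≡ 3 → 3 ℕ.≤ q
    lemma (suc (suc (suc _))) _ = s≤s (s≤s (s≤s z≤n))

  N∤2 : ¬ N ∣ + 2
  N∤2 = N∤small 2 z<s 3≤p

  roots : ℤ → ℤ
  roots a = ∑ₙ (λ y → δ (y * y - a))

  roots-periodic : Periodic roots
  roots-periodic a b N∣a-b = ∑ₙ-cong λ y →
    δ-periodic (y * y - a) (y * y - b) (subst (N ∣_) (shift y a b) (∣m⇒∣-m {N} {a - b} N∣a-b))
    where
    shift : ∀ y a b → - (a - b) ≡ (y * y - a) - (y * y - b)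
    shift = solve-∀

  roots-0 : roots (+ 0) ≡ + 1
  roots-0 = trans (∑ₙ-cong λ y → δ-cong {y * y - + 0} {y - + 0} (N∣y² y) (N∣y⇒N∣y² y)) (∑ₙ-δ (+ 0))
    where
    y²-0 : ∀ y → y * y - + 0 ≡ y * y
    y²-0 y = ℤP.+-identityʳ (y * y)
    N∣y² : ∀ y → N ∣ y * y - + 0 → N ∣ y - + 0
    N∣y² y N∣y² with euclid y y (subst (N ∣_) (y²-0 y) N∣y²)
    ... | inj₁ N∣y = subst (N ∣_) (sym (ℤP.+-identityʳ y)) N∣y
    ... | inj₂ N∣y = subst (N ∣_) (sym (ℤP.+-identityʳ y)) N∣y
    N∣y⇒N∣y² : ∀ y → N ∣ y - + 0 → N ∣ y * y - + 0
    N∣y⇒N∣y² y N∣y = subst (N ∣_) (sym (y²-0 y)) (∣m⇒∣m*n {N} y {y} (subst (N ∣_) (ℤP.+-identityʳ y) N∣y))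

  roots-0-or-2 : ∀ a → ¬ N ∣ a → (roots a ≡ + 0) ⊎ (roots a ≡ + 2)
  roots-0-or-2 a N∤a with ℕP.anyUpTo? (λ k → N ∣? (+ k * + k - a)) p
  ... | no no-root = inj₁ (∑-zero p _ (λ k k<p → δ-no (λ N∣ → no-root (k , k<p , N∣))))
  ... | yes (y₀ , _ , N∣y₀²-a) = inj₂ (begin
    ∑ₙ (λ y → δ (y * y - a))                  ≡⟨ ∑ₙ-cong two-roots ⟩
    ∑ₙ (λ y → δ (y - Y) + δ (y - - Y))        ≡⟨ ∑ₙ-+ (λ y → δ (y - Y)) (λ y → δ (y - - Y)) ⟩
    ∑ₙ (λ y → δ (y - Y)) + ∑ₙ (λ y → δ (y - - Y)) ≡⟨ cong₂ _+_ (∑ₙ-δ Y) (∑ₙ-δ (- Y)) ⟩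
    + 2                                       ∎)
    where
    open ≡-Reasoning
    Y = + y₀
    difference-of-squares : ∀ y a Y → y * y - a ≡ (y - Y) * (y + Y) + (Y * Y - a)
    difference-of-squares = solve-∀
    y--Y : ∀ y Y → y - - Y ≡ y + Y
    y--Y = solve-∀
    sum-of-roots : ∀ y Y → (y + Y) - (y - Y) ≡ + 2 * Y
    sum-of-roots = solve-∀
    Y²-[Y²-a] : ∀ Y a → Y * Y - (Y * Y - a) ≡ a
    Y²-[Y²-a] = solve-∀
    N∤Y : ¬ N ∣ Y
    N∤Y N∣Y = N∤a (subst (N ∣_) (Y²-[Y²-a] Y a) (∣m∣n⇒∣m-n {N} {Y * Y} {Y * Y - a} (∣m⇒∣m*n {N} Y {Y} N∣Y) N∣y₀²-a))
    factor : ∀ y → N ∣ y * y - a → N ∣ (y - Y) * (y + Y)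
    factor y N∣ = subst (N ∣_)
      (trans (cong (_- (Y * Y - a)) (difference-of-squares y a Y)) (m+n-n≡m ((y - Y) * (y + Y)) (Y * Y - a)))
      (∣m∣n⇒∣m-n {N} {y * y - a} {Y * Y - a} N∣ N∣y₀²-a)
    from-factor : ∀ y → N ∣ (y - Y) * (y + Y) → N ∣ y * y - a
    from-factor y N∣ = subst (N ∣_) (sym (difference-of-squares y a Y))
                         (∣m∣n⇒∣m+n {N} {(y - Y) * (y + Y)} {Y * Y - a} N∣ N∣y₀²-a)
    two-roots : ∀ y → δ (y * y - a) ≡ δ (y - Y) + δ (y - - Y)
    two-roots y with N ∣? (y - Y) | N ∣? (y - - Y)
    ... | yes N∣y-Y | yes N∣y+Y = ⊥-elim ([ N∤2 , N∤Y ] (euclid (+ 2) Y (subst (N ∣_) (sum-of-roots y Y)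
            (∣m∣n⇒∣m-n {N} {y + Y} {y - Y} (subst (N ∣_) (y--Y y Y) N∣y+Y) N∣y-Y))))
    ... | yes N∣y-Y | no  _     = δ-yes (from-factor y (∣m⇒∣m*n {N} (y + Y) {y - Y} N∣y-Y))
    ... | no  _     | yes N∣y+Y = δ-yes (from-factor y (∣n⇒∣m*n {N} (y - Y) {y + Y} (subst (N ∣_) (y--Y y Y) N∣y+Y)))
    ... | no  N∤y-Y | no  N∤y+Y = δ-no λ N∣ →
            [ N∤y-Y , (λ N∣y+Y → N∤y+Y (subst (N ∣_) (sym (y--Y y Y)) N∣y+Y)) ] (euclid (y - Y) (y + Y) (factor y N∣))

  ∑ₙ-δ-affine : ∀ d → ¬ N ∣ d → ∀ u → ∑ₙ (λ y → δ (u * (u + + 2 * y) - d)) ≡ + 1 - δ u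
  ∑ₙ-δ-affine d N∤d u with N ∣? u
  ... | yes N∣u = begin
    ∑ₙ (λ y → δ (u * (u + + 2 * y) - d))  ≡⟨ ∑ₙ-cong (λ y → δ-no {u * (u + + 2 * y) - d} (N∤d ∘ N∣d y)) ⟩
    ∑ₙ (λ _ → + 0)                         ≡⟨ ∑ₙ-const (+ 0) ⟩
    N * + 0                                ≡⟨ ℤP.*-zeroʳ N ⟩
    + 0                                    ∎
    where
    open ≡-Reasoning
    x-[x-d] : ∀ x d → x - (x - d) ≡ d
    x-[x-d] = solve-∀
    N∣d : ∀ y → N ∣ u * (u + + 2 * y) - d → N ∣ d
    N∣d y N∣ = subst (N ∣_) (x-[x-d] (u * (u + + 2 * y)) d)
      (∣m∣n⇒∣m-n {N} {u * (u + + 2 * y)} {u * (u + + 2 * y) - d} (∣m⇒∣m*n {N} (u + + 2 * y) {u} N∣u) N∣)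
  ... | no N∤u with modular-inverse (+ 2 * u) N∤2u
    where
    N∤2u : ¬ N ∣ + 2 * u
    N∤2u N∣2u = [ N∤2 , N∤u ] (euclid (+ 2) u N∣2u)
  ... | v , N∣2uv-1 = trans (∑ₙ-cong unique-solution) (∑ₙ-δ y₀)
    where
    y₀ = (d - u * u) * v
    E = (d - u * u) * ((+ 2 * u) * v - + 1)
    N∣E : N ∣ E
    N∣E = ∣n⇒∣m*n {N} (d - u * u) {(+ 2 * u) * v - + 1} N∣2uv-1
    N∤2u : ¬ N ∣ + 2 * u
    N∤2u N∣2u = [ N∤2 , N∤u ] (euclid (+ 2) u N∣2u)
    complete : ∀ u y d v → u * (u + + 2 * y) - d ≡ (+ 2 * u) * (y - (d - u * u) * v) + (d - u * u) * ((+ 2 * u) * v - + 1)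
    complete = solve-∀
    unique-solution : ∀ y → δ (u * (u + + 2 * y) - d) ≡ δ (y - y₀)
    unique-solution y = δ-cong {u * (u + + 2 * y) - d} {y - y₀} to from
      where
      to : N ∣ u * (u + + 2 * y) - d → N ∣ y - y₀
      to N∣ with euclid (+ 2 * u) (y - y₀) (subst (N ∣_)
                    (trans (cong (_- E) (complete u y d v)) (m+n-n≡m ((+ 2 * u) * (y - y₀)) E))
                    (∣m∣n⇒∣m-n {N} {u * (u + + 2 * y) - d} {E} N∣ N∣E))
      ... | inj₁ N∣2u = ⊥-elim (N∤2u N∣2u)
      ... | inj₂ N∣y-y₀ = N∣y-y₀
      from : N ∣ y - y₀ → N ∣ u * (u + + 2 * y) - d
      from N∣y-y₀ = subst (N ∣_) (sym (complete u y d v))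
        (∣m∣n⇒∣m+n {N} {(+ 2 * u) * (y - y₀)} {E} (∣n⇒∣m*n {N} (+ 2 * u) {y - y₀} N∣y-y₀) N∣E)

  -- ∑ₖ roots(k) roots(k+d) counts the pairs (y, z) with z² - y² ≡ d; writing z = y + u,
  -- for each u ≢ 0 there is exactly one y with u (u + 2y) ≡ d.
  roots-autocorrelation : ∀ d → ¬ N ∣ d → ∑ₙ (λ k → roots k * roots (k + d)) ≡ N - + 1
  roots-autocorrelation d N∤d = begin
      ∑ₙ (λ k → roots k * roots (k + d))
    ≡⟨ ∑ₙ-cong (λ k → sym (∑-*ʳ p (roots (k + d)) (λ y → δ (+ y * + y - k)))) ⟩
      ∑ₙ (λ k → ∑ₙ (λ y → δ (y * y - k) * roots (k + d)))
    ≡⟨ ∑ₙ-swap (λ k y → δ (y * y - k) * roots (k + d)) ⟩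
      ∑ₙ (λ y → ∑ₙ (λ k → δ (y * y - k) * roots (k + d)))
    ≡⟨ ∑ₙ-cong (λ y → trans (∑ₙ-cong (λ k → trans (cong (_* roots (k + d)) (δ-swap (y * y) k))
                                                     (ℤP.*-comm (δ (k - y * y)) (roots (k + d)))))
                             (∑ₙ-sift (λ k → roots (k + d)) (periodic-translate roots-periodic d) (y * y))) ⟩
      ∑ₙ (λ y → roots (y * y + d))
    ≡⟨ ∑ₙ-cong (λ y → trans (sym (∑ₙ-translate (λ z → δ (z * z - (y * y + d))) (squares-periodic (y * y + d)) y))
                            (∑ₙ-cong (λ u → cong δ (expand u y d)))) ⟩
      ∑ₙ (λ y → ∑ₙ (λ u → δ (u * (u + + 2 * y) - d)))
    ≡⟨ ∑ₙ-swap (λ y u → δ (u * (u + + 2 * y) - d)) ⟩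
      ∑ₙ (λ u → ∑ₙ (λ y → δ (u * (u + + 2 * y) - d)))
    ≡⟨ ∑ₙ-cong (∑ₙ-δ-affine d N∤d) ⟩
      ∑ₙ (λ u → + 1 - δ u)
    ≡⟨ ∑ₙ-- (λ _ → + 1) δ ⟩
      ∑ₙ (λ _ → + 1) - ∑ₙ δ
    ≡⟨ cong₂ _-_ ∑ₙ-1 ∑ₙ-δ-0 ⟩
      N - + 1
    ∎
    where
    open ≡-Reasoning
    expand : ∀ u y d → (u + y) * (u + y) - (y * y + d) ≡ u * (u + + 2 * y) - d
    expand = solve-∀
    difference-of-squares : ∀ a b c → (a - b) * (a + b) ≡ (a * a - c) - (b * b - c)
    difference-of-squares = solve-∀
    squares-periodic : ∀ c → Periodic (λ z → δ (z * z - c))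
    squares-periodic c a b N∣a-b = δ-periodic (a * a - c) (b * b - c)
      (subst (N ∣_) (difference-of-squares a b c) (∣m⇒∣m*n {N} (a + b) {a - b} N∣a-b))

  4∣N-3 : + 4 ∣ N - + 3
  4∣N-3 = subst (+ 4 ∣_) (sym N-3≡q*4) (n∣m*n (+ 4) (+ (p ℕ./ 4)))
    where
    p≡3+q*4 : p ≡ 3 ℕ.+ (p ℕ./ 4) ℕ.* 4
    p≡3+q*4 = trans (m≡m%n+[m/n]*n p 4) (cong (ℕ._+ (p ℕ./ 4) ℕ.* 4) p%4≡3)
    N-3≡q*4 : N - + 3 ≡ + (p ℕ./ 4) * + 4
    N-3≡q*4 = begin
      N - + 3                              ≡⟨ cong (λ t → + t - + 3) p≡3+q*4 ⟩
      + (3 ℕ.+ (p ℕ./ 4) ℕ.* 4) - + 3      ≡⟨ cong (λ t → + 3 + t - + 3) (ℤP.pos-* (p ℕ./ 4) 4) ⟩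
      + 3 + + (p ℕ./ 4) * + 4 - + 3        ≡⟨ m+n-m≡n (+ 3) _ ⟩
      + (p ℕ./ 4) * + 4                    ∎
      where open ≡-Reasoning

  module _ (d : ℤ) (N∤d : ¬ N ∣ d) where

    private
      ρ : ℤ → ℤ
      ρ k = roots k * roots (k + d)

      ρ-periodic : Periodic ρ
      ρ-periodic = periodic-* roots-periodic (periodic-translate roots-periodic d)

      rest : ℤ → ℤ
      rest k = ρ k * (+ 1 - δ k - δ (k + d))

      ∑ₙ-ρ·δ : ∑ₙ (λ k → ρ k * δ k) ≡ roots d
      ∑ₙ-ρ·δ = begin
        ∑ₙ (λ k → ρ k * δ k)            ≡⟨ ∑ₙ-cong (λ k → cong (ρ k *_) (sym (δ-0 k))) ⟩
        ∑ₙ (λ k → ρ k * δ (k - + 0))    ≡⟨ ∑ₙ-sift ρ ρ-periodic (+ 0) ⟩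
        roots (+ 0) * roots (+ 0 + d)   ≡⟨ cong₂ _*_ roots-0 (cong roots (ℤP.+-identityˡ d)) ⟩
        + 1 * roots d                   ≡⟨ ℤP.*-identityˡ (roots d) ⟩
        roots d                         ∎
        where open ≡-Reasoning

      ∑ₙ-ρ·δ+d : ∑ₙ (λ k → ρ k * δ (k + d)) ≡ roots (- d)
      ∑ₙ-ρ·δ+d = begin
        ∑ₙ (λ k → ρ k * δ (k + d))          ≡⟨ ∑ₙ-cong (λ k → cong (λ t → ρ k * δ (k + t)) (sym (ℤP.neg-involutive d))) ⟩
        ∑ₙ (λ k → ρ k * δ (k - - d))        ≡⟨ ∑ₙ-sift ρ ρ-periodic (- d) ⟩
        roots (- d) * roots (- d + d)       ≡⟨ cong (λ t → roots (- d) * roots t) (ℤP.+-inverseˡ d) ⟩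
        roots (- d) * roots (+ 0)           ≡⟨ cong (roots (- d) *_) roots-0 ⟩
        roots (- d) * + 1                   ≡⟨ ℤP.*-identityʳ (roots (- d)) ⟩
        roots (- d)                         ∎
        where open ≡-Reasoning

      4∣rest : ∀ k → + 4 ∣ rest k
      4∣rest k with N ∣? k | N ∣? (k + d)
      ... | yes N∣k | yes N∣k+d = ⊥-elim (N∤d (subst (N ∣_) (m+n-m≡n k d) (∣m∣n⇒∣m-n {N} {k + d} {k} N∣k+d N∣k)))
      ... | yes _   | no _      = ∣n⇒∣m*n {+ 4} (ρ k) {+ 0} (ℕD._∣0 4)
      ... | no _    | yes _     = ∣n⇒∣m*n {+ 4} (ρ k) {+ 0} (ℕD._∣0 4)
      ... | no N∤k  | no N∤k+d  = ∣m⇒∣m*n {+ 4} (+ 1) {ρ k} (product (roots-0-or-2 k N∤k) (roots-0-or-2 (k + d) N∤k+d))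
        where
        product : (roots k ≡ + 0) ⊎ (roots k ≡ + 2) → (roots (k + d) ≡ + 0) ⊎ (roots (k + d) ≡ + 2) → + 4 ∣ ρ k
        product (inj₁ e) _ = subst (+ 4 ∣_) (sym (trans (cong (_* roots (k + d)) e) (ℤP.*-zeroˡ (roots (k + d))))) (ℕD._∣0 4)
        product (inj₂ _) (inj₁ e) = subst (+ 4 ∣_) (sym (trans (cong (roots k *_) e) (ℤP.*-zeroʳ (roots k)))) (ℕD._∣0 4)
        product (inj₂ e) (inj₂ e′) = subst (+ 4 ∣_) (sym (cong₂ _*_ e e′)) ℕD.∣-refl

      N-1≡roots±d+rest : N - + 1 ≡ (roots d + roots (- d)) + ∑ₙ rest
      N-1≡roots±d+rest = begin
        N - + 1                                                      ≡⟨ roots-autocorrelation d N∤d ⟨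
        ∑ₙ ρ                                                          ≡⟨ ∑ₙ-cong (λ k → split (ρ k) (δ k) (δ (k + d))) ⟩
        ∑ₙ (λ k → ρ k * δ k + ρ k * δ (k + d) + rest k)               ≡⟨ ∑ₙ-+ (λ k → ρ k * δ k + ρ k * δ (k + d)) rest ⟩
        ∑ₙ (λ k → ρ k * δ k + ρ k * δ (k + d)) + ∑ₙ rest
          ≡⟨ cong (_+ ∑ₙ rest) (∑ₙ-+ (λ k → ρ k * δ k) (λ k → ρ k * δ (k + d))) ⟩
        ∑ₙ (λ k → ρ k * δ k) + ∑ₙ (λ k → ρ k * δ (k + d)) + ∑ₙ rest
          ≡⟨ cong (_+ ∑ₙ rest) (cong₂ _+_ ∑ₙ-ρ·δ ∑ₙ-ρ·δ+d) ⟩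
        roots d + roots (- d) + ∑ₙ rest                              ∎
        where
        open ≡-Reasoning
        split : ∀ x a b → x ≡ x * a + x * b + x * (+ 1 - a - b)
        split = solve-∀

      4∣2-roots±d : + 4 ∣ + 2 - (roots d + roots (- d))
      4∣2-roots±d = subst (+ 4 ∣_) (shift N s)
        (∣m∣n⇒∣m-n {+ 4} {(N - + 1) - s} {N - + 3}
          (subst (+ 4 ∣_) (sym (trans (cong (_- s) N-1≡roots±d+rest) (m+n-m≡n s (∑ₙ rest)))) (∣-∑ {+ 4} p (rest ∘ +_) (4∣rest ∘ +_)))
          4∣N-3)
        where
        s = roots d + roots (- d)
        shift : ∀ x s → ((x - + 1) - s) - (x - + 3) ≡ + 2 - s
        shift = solve-∀

    -- In ∑ₖ roots(k) roots(k+d) the terms with k ≡ 0 and k ≡ -d are roots(d) and roots(-d), and every other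
    -- term is 0 or 4; since N - 1 ≡ 2 (mod 4), roots(d) + roots(-d) ∈ {0, 2, 4} must be 2.
    roots-opposite : roots d + roots (- d) ≡ + 2
    roots-opposite = 4∣2-x-y⇒x+y≡2 (roots-0-or-2 d N∤d) (roots-0-or-2 (- d) (N∤d ∘ ∣-m⇒∣m {N} {d})) 4∣2-roots±d

  ∑ₙ-roots : ∑ₙ roots ≡ N
  ∑ₙ-roots = begin
    ∑ₙ (λ k → ∑ₙ (λ y → δ (y * y - k)))  ≡⟨ ∑ₙ-swap (λ k y → δ (y * y - k)) ⟩
    ∑ₙ (λ y → ∑ₙ (λ k → δ (y * y - k)))  ≡⟨ ∑ₙ-cong (λ y → trans (∑ₙ-cong (λ k → δ-swap (y * y) k)) (∑ₙ-δ (y * y))) ⟩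
    ∑ₙ (λ _ → + 1)                       ≡⟨ ∑ₙ-1 ⟩
    N                                    ∎
    where open ≡-Reasoning

  -- χ is the quadratic character modulo p, except that χ 0 = 1: roots a = 1 + χ a for a ≢ 0.
  ε : ℤ → ℤ
  ε a = δ a - + 1

  χ : ℤ → ℤ
  χ a = roots a + ε a

  χ-periodic : Periodic χ
  χ-periodic = periodic-+ roots-periodic (periodic-+ δ-periodic (λ _ _ _ → refl))

  χ-±1 : ∀ a → ±1 (χ a)
  χ-±1 a with N ∣? a
  ... | yes N∣a = inj₁ (cong (_+ (+ 1 - + 1)) (trans (roots-periodic a (+ 0) (subst (N ∣_) (sym (ℤP.+-identityʳ a)) N∣a)) roots-0))
  ... | no  N∤a with roots-0-or-2 a N∤a
  ...   | inj₁ r≡0 = inj₂ (cong (_+ (+ 0 - + 1)) r≡0)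
  ...   | inj₂ r≡2 = inj₁ (cong (_+ (+ 0 - + 1)) r≡2)

  χ-energy : ∑ₙ (λ k → χ k * χ k) ≡ N
  χ-energy = trans (∑ₙ-cong square) ∑ₙ-1
    where
    square : ∀ k → χ k * χ k ≡ + 1
    square k with χ-±1 k
    ... | inj₁ e = cong₂ _*_ e e
    ... | inj₂ e = cong₂ _*_ e e

  module _ (d : ℤ) (N∤d : ¬ N ∣ d) where

    private
      ∑ₙ-roots-translate : ∑ₙ (λ k → roots (k + d)) ≡ N
      ∑ₙ-roots-translate = trans (∑ₙ-translate roots roots-periodic d) ∑ₙ-roots

      ∑ₙ-roots·ε : ∑ₙ (λ k → roots k * ε (k + d)) ≡ roots (- d) - N
      ∑ₙ-roots·ε = begin
        ∑ₙ (λ k → roots k * ε (k + d))                          ≡⟨ ∑ₙ-cong (λ k → ℤP.*-distribˡ-+ (roots k) (δ (k + d)) (- + 1)) ⟩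
        ∑ₙ (λ k → roots k * δ (k + d) + roots k * - + 1)         ≡⟨ ∑ₙ-+ (λ k → roots k * δ (k + d)) (λ k → roots k * - + 1) ⟩
        ∑ₙ (λ k → roots k * δ (k + d)) + ∑ₙ (λ k → roots k * - + 1)
          ≡⟨ cong₂ _+_ (trans (∑ₙ-cong (λ k → cong (λ t → roots k * δ (k + t)) (sym (ℤP.neg-involutive d))))
                              (∑ₙ-sift roots roots-periodic (- d)))
                       (trans (∑ₙ-cong (λ k → ℤP.*-comm (roots k) (- + 1))) (trans (∑ₙ-*ˡ (- + 1) roots) (cong (- + 1 *_) ∑ₙ-roots))) ⟩
        roots (- d) + - + 1 * N                                  ≡⟨ cong (_+_ (roots (- d))) (ℤP.-1*i≡-i N) ⟩
        roots (- d) - N                                          ∎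
        where open ≡-Reasoning

      ∑ₙ-ε·roots : ∑ₙ (λ k → ε k * roots (k + d)) ≡ roots d - N
      ∑ₙ-ε·roots = begin
        ∑ₙ (λ k → ε k * roots (k + d))                          ≡⟨ ∑ₙ-cong (λ k → ℤP.*-distribʳ-+ (roots (k + d)) (δ k) (- + 1)) ⟩
        ∑ₙ (λ k → δ k * roots (k + d) + - + 1 * roots (k + d))   ≡⟨ ∑ₙ-+ (λ k → δ k * roots (k + d)) (λ k → - + 1 * roots (k + d)) ⟩
        ∑ₙ (λ k → δ k * roots (k + d)) + ∑ₙ (λ k → - + 1 * roots (k + d))
          ≡⟨ cong₂ _+_ (trans (∑ₙ-cong (λ k → trans (ℤP.*-comm (δ k) (roots (k + d))) (cong (roots (k + d) *_) (sym (δ-0 k)))))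
                              (trans (∑ₙ-sift (λ k → roots (k + d)) (periodic-translate roots-periodic d) (+ 0))
                                     (cong roots (ℤP.+-identityˡ d))))
                       (trans (∑ₙ-*ˡ (- + 1) (λ k → roots (k + d))) (cong (- + 1 *_) ∑ₙ-roots-translate)) ⟩
        roots d + - + 1 * N                                      ≡⟨ cong (_+_ (roots d)) (ℤP.-1*i≡-i N) ⟩
        roots d - N                                              ∎
        where open ≡-Reasoning

      ∑ₙ-ε·ε : ∑ₙ (λ k → ε k * ε (k + d)) ≡ N - + 2
      ∑ₙ-ε·ε = begin
        ∑ₙ (λ k → ε k * ε (k + d))                   ≡⟨ ∑ₙ-cong pointwise ⟩
        ∑ₙ (λ k → + 1 - δ k - δ (k + d))             ≡⟨ ∑ₙ-- (λ k → + 1 - δ k) (λ k → δ (k + d)) ⟩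
        ∑ₙ (λ k → + 1 - δ k) - ∑ₙ (λ k → δ (k + d))  ≡⟨ cong₂ _-_ (∑ₙ-- (λ _ → + 1) δ) (∑ₙ-translate δ δ-periodic d) ⟩
        (∑ₙ (λ _ → + 1) - ∑ₙ δ) - ∑ₙ δ               ≡⟨ cong₂ (λ s t → (s - t) - t) ∑ₙ-1 ∑ₙ-δ-0 ⟩
        (N - + 1) - + 1                              ≡⟨ two N ⟩
        N - + 2                                      ∎
        where
        open ≡-Reasoning
        two : ∀ x → (x - + 1) - + 1 ≡ x - + 2
        two = solve-∀
        pointwise : ∀ k → ε k * ε (k + d) ≡ + 1 - δ k - δ (k + d)
        pointwise k with N ∣? k | N ∣? (k + d)
        ... | yes N∣k | yes N∣k+d = ⊥-elim (N∤d (subst (N ∣_) (m+n-m≡n k d) (∣m∣n⇒∣m-n {N} {k + d} {k} N∣k+d N∣k)))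
        ... | yes _   | no  _     = refl
        ... | no  _   | yes _     = refl
        ... | no  _   | no  _     = refl

    χ-autocorrelation : ∑ₙ (λ k → χ k * χ (k + d)) ≡ - + 1
    χ-autocorrelation = begin
      ∑ₙ (λ k → χ k * χ (k + d))
        ≡⟨ ∑ₙ-cong (λ k → expand (roots k) (ε k) (roots (k + d)) (ε (k + d))) ⟩
      ∑ₙ (λ k → rr k + rε k + εr k + εε k)
        ≡⟨ trans (∑ₙ-+ (λ k → rr k + rε k + εr k) εε)
                 (cong (_+ ∑ₙ εε) (trans (∑ₙ-+ (λ k → rr k + rε k) εr) (cong (_+ ∑ₙ εr) (∑ₙ-+ rr rε)))) ⟩
      ∑ₙ rr + ∑ₙ rε + ∑ₙ εr + ∑ₙ εε
        ≡⟨ cong₂ _+_ (cong₂ _+_ (cong₂ _+_ (roots-autocorrelation d N∤d) ∑ₙ-roots·ε) ∑ₙ-ε·roots) ∑ₙ-ε·ε ⟩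
      (N - + 1) + (roots (- d) - N) + (roots d - N) + (N - + 2)
        ≡⟨ collect N (roots d) (roots (- d)) ⟩
      (roots d + roots (- d)) - + 3
        ≡⟨ cong (_- + 3) (roots-opposite d N∤d) ⟩
      - + 1
        ∎
      where
      open ≡-Reasoning
      rr rε εr εε : ℤ → ℤ
      rr k = roots k * roots (k + d)
      rε k = roots k * ε (k + d)
      εr k = ε k * roots (k + d)
      εε k = ε k * ε (k + d)
      expand : ∀ a b c e → (a + b) * (c + e) ≡ a * c + a * e + b * c + b * e
      expand = solve-∀
      collect : ∀ x r s → (x - + 1) + (s - x) + (r - x) + (x - + 2) ≡ (r + s) - + 3
      collect = solve-∀

  open Circulants p

  χ-gram : ⟪ circulant χ , circulant χ ⟫ ≐ (((N + + 1) · I) ⊕ neg J)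
  χ-gram i j = begin
    ⟪ circulant χ , circulant χ ⟫ i j           ≡⟨ ⟪⟫-corr hχ hχ i j ⟩
    ∑ₙ (λ k → χ (k - ι i) * χ (k - ι j))
      ≡⟨ ∑ₙ-reindex-translate F (periodic-* χ-periodic (periodic-translate χ-periodic (ι i - ι j))) (- ι i) _
           (λ k → cong (λ t → χ (k - ι i) * χ t) (sym (ℤP.+-minus-telescope k (ι i) (ι j)))) ⟩
    ∑ₙ F                                        ≡⟨ by-cases (i ≟ᶠ j) ⟩
    (N + + 1) * I i j + - + 1                   ∎
    where
    open ≡-Reasoning
    hχ : HasEntries (circulant χ) (circᵉ χ)
    hχ = hasEntries-circᵉ {f = χ} (λ _ _ → refl)
    F : ℤ → ℤ
    F t = χ t * χ (t + (ι i - ι j))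
    by-cases : Dec (i ≡ j) → ∑ₙ F ≡ (N + + 1) * I i j + - + 1
    by-cases (yes refl) = begin
      ∑ₙ (λ t → χ t * χ (t + (ι i - ι i)))
        ≡⟨ ∑ₙ-cong (λ t → cong (λ u → χ t * χ u) (trans (cong (_+_ t) (ℤP.+-inverseʳ (ι i))) (ℤP.+-identityʳ t))) ⟩
      ∑ₙ (λ t → χ t * χ t)                  ≡⟨ χ-energy ⟩
      N                                     ≡⟨ diagonal N ⟩
      (N + + 1) * + 1 + - + 1               ≡⟨ cong (λ e → (N + + 1) * e + - + 1) (I-diagonal i) ⟨
      (N + + 1) * I i i + - + 1             ∎
      where
      diagonal : ∀ x → x ≡ (x + + 1) * + 1 + - + 1
      diagonal = solve-∀
    by-cases (no i≢j) = begin
      ∑ₙ F                                  ≡⟨ χ-autocorrelation (ι i - ι j) (N∤ι-ι i≢j) ⟩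
      - + 1                                 ≡⟨ off-diagonal N ⟩
      (N + + 1) * + 0 + - + 1               ≡⟨ cong (λ e → (N + + 1) * e + - + 1) (I-off-diagonal i≢j) ⟨
      (N + + 1) * I i j + - + 1             ∎
      where
      off-diagonal : ∀ x → - + 1 ≡ (x + + 1) * + 0 + - + 1
      off-diagonal = solve-∀

propus-condition : ∀ {n} (X Y B : Mat n) →
  ((X ⊗ (X ᵀ)) ⊕ (Y ⊗ (Y ᵀ))) ≐ ((((+ (2 ℕ.* n)) - (+ 2)) · I) ⊕ ((+ 2) · J)) →
  ⟪ B , B ⟫ ≐ (((+ n + + 1) · I) ⊕ neg J) →
  ((⟪ X , X ⟫ ⊕ ((+ 2) · ⟪ B , B ⟫)) ⊕ ⟪ Y , Y ⟫) ≐ ((+ (4 ℕ.* n)) · I)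
propus-condition {n} X Y B XXᵀ+YYᵀ BBᵀ i j = begin
  (⟪ X , X ⟫ i j + + 2 * ⟪ B , B ⟫ i j) + ⟪ Y , Y ⟫ i j
    ≡⟨ regroup (⟪ X , X ⟫ i j) (⟪ B , B ⟫ i j) (⟪ Y , Y ⟫ i j) ⟩
  (⟪ X , X ⟫ i j + ⟪ Y , Y ⟫ i j) + + 2 * ⟪ B , B ⟫ i j
    ≡⟨ cong₂ (λ s t → s + + 2 * t) (XXᵀ+YYᵀ i j) (BBᵀ i j) ⟩
  ((+ (2 ℕ.* n) - + 2) * I i j + + 2 * + 1) + + 2 * ((+ n + + 1) * I i j + - + 1)
    ≡⟨ cong (λ t → ((t - + 2) * I i j + + 2 * + 1) + + 2 * ((+ n + + 1) * I i j + - + 1)) (ℤP.pos-* 2 n) ⟩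
  ((+ 2 * + n - + 2) * I i j + + 2 * + 1) + + 2 * ((+ n + + 1) * I i j + - + 1)
    ≡⟨ collect (+ n) (I i j) ⟩
  (+ 4 * + n) * I i j
    ≡⟨ cong (_* I i j) (ℤP.pos-* 4 n) ⟨
  + (4 ℕ.* n) * I i j
    ∎
  where
  open ≡-Reasoning
  regroup : ∀ a b d → (a + + 2 * b) + d ≡ (a + d) + + 2 * b
  regroup = solve-∀
  collect : ∀ x e → ((+ 2 * x - + 2) * e + + 2 * + 1) + + 2 * ((x + + 1) * e + - + 1) ≡ (+ 4 * x) * e
  collect = solve-∀

mainTheorem2 : (n : ℕ) → Prime n → n % 4 ≡ 3 →
    ∃[ X ] ∃[ Y ] (IsPM1 {n} X × IsPM1 Y × Circulant X × Circulant Y × Symmetric X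
    × ((X ⊗ (X ᵀ)) ⊕ (Y ⊗ (Y ᵀ))) ≐ ((((+ (2 ℕ.* n)) - (+ 2)) · I) ⊕ ((+ 2) · J))) →
    ∃[ H ] IsPropusHadamard n H
mainTheorem2 zero      _       ()
mainTheorem2 n@(suc m) n-prime n%4≡3 (X , Y , ±X , ±Y , cX , cY , _ , XXᵀ+YYᵀ) =
  genPropus X B Y , (genPropus-IsPM1 ±X ±B ±Y , genPropus-orthogonal (+ (4 ℕ.* n)) gram) ,
  X , B , Y , ±X , ±B , ±Y , gram , inj₂ (λ _ _ → refl)
  where
  open QuadraticResidues n n-prime n%4≡3
  open FirstRow m
  open Circulants n using (ι; circulant)
  B = circulant χ
  ±B : IsPM1 B
  ±B i j = χ-±1 (ι j - ι i)
  open GeneralisedPropus n (periodic-firstRow cX) χ-periodic (periodic-firstRow cY)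
                           (circulant-firstRow cX) (λ _ _ → refl) (circulant-firstRow cY)
  gram : G ≐ ((+ (4 ℕ.* n)) · I)
  gram = propus-condition X Y B XXᵀ+YYᵀ χ-gram
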